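{- Let $\varepsilon>0$ and $k\ge 1$. Let $G_1,G_2$ be $d$-bounded $n$-vertex graphs such that $G_1$ is $\varepsilon$-close to $G_2$. Then $\|\mathrm{freq}_k(G_1)-\mathrm{freq}_k(G_2)\|_1<6\varepsilon d^{k+1}$.
   Context: A graph is $d$-bounded if its maximum degree is at most $d$. $G_1$ is $\varepsilon$-close to $G_2$ if $G_2$ can be obtained from $G_1$ by modifying (inserting or deleting) at most $\varepsilon d n$ edges. For a vertex $v$ of $G$, its $k$-disc is the subgraph of $G$ induced by all vertices at distance at most $k$ from $v$, rooted at $v$; two rooted graphs are isomorphic if there is a root-preserving graph isomorphism. Let $\Delta_1,\dots,\Delta_N$ be all isomorphism types of $k$-discs of $d$-bounded graphs. The frequency vector $\mathrm{freq}_k(G)$ of an $n$-vertex graph $G$ is the vector indexed by these types whose $\Delta$-entry is the fraction of vertices of $G$ whose $k$-disc is isomorphic to $\Delta$. $\|\cdot\|_1$ is the $\ell_1$-norm.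
   Formalization: The parameter ε ranges over the positive rationals. -}

module Defs where

open import Data.Bool using (Bool; true; false; _∧_; _∨_; not; if_then_else_; _xor_)
open import Data.Nat as ℕ using (ℕ; zero; suc; NonZero)
open import Data.Fin as Fin using (Fin)
open import Data.List using (List; []; _∷_; map; concatMap; allFin; foldr)
open import Data.Bool.ListAction using (all; any)
open import Data.Vec as Vec using (Vec; lookup)
open import Data.Integer using (+_)
open import Data.Rational using (ℚ; _/_; _+_; _-_; ∣_∣; 0ℚ)
open import Relation.Binary.PropositionalEquality using (_≡_)
open import Relation.Nullary.Decidable using (⌊_⌋)

record Graph (n : ℕ) : Set where
  field
    adj    : Fin n → Fin n → Bool
    adj-sym : ∀ u v → adj u v ≡ adj v u
    irrefl : ∀ v → adj v v ≡ false
open Graph public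

countV : {n : ℕ} → (Fin n → Bool) → ℕ
countV {n} p = foldr (λ v acc → if p v then suc acc else acc) 0 (allFin n)

deg : {n : ℕ} → Graph n → Fin n → ℕ
deg G u = countV (adj G u)

Bounded : {n : ℕ} → ℕ → Graph n → Set
Bounded d G = ∀ u → deg G u ℕ.≤ d

editDist : {n : ℕ} → Graph n → Graph n → ℕ
editDist G₁ G₂ =
  foldr ℕ._+_ 0 (map (λ u → countV (λ v → ⌊ u Fin.<? v ⌋ ∧ (adj G₁ u v xor adj G₂ u v))) (allFin _))

ℕtoℚ : ℕ → ℚ
ℕtoℚ m = + m / 1

Close : {n : ℕ} → ℚ → ℕ → Graph n → Graph n → Set
Close {n} ε d G₁ G₂ = ℕtoℚ (editDist G₁ G₂) Data.Rational.≤ (ε Data.Rational.* ℕtoℚ d) Data.Rational.* ℕtoℚ n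

within : {n : ℕ} → Graph n → ℕ → Fin n → Fin n → Bool
within G zero    u v = ⌊ u Fin.≟ v ⌋
within G (suc j) u v = within G j u v ∨ any (λ w → within G j u w ∧ adj G w v) (allFin _)

allVecs : (n m : ℕ) → List (Vec (Fin n) m)
allVecs n zero    = Vec.[] ∷ []
allVecs n (suc m) = concatMap (λ x → map (x Vec.∷_) (allVecs n m)) (allFin n)

-- The k-disc of G at v (induced subgraph on {w | dist(v,w) ≤ k}, rooted at v) is
-- isomorphic as a rooted graph to the k-disc of H at u: there are maps f, g that are
-- mutually inverse bijections between the two vertex sets, send v to u, and preserve
-- adjacency in the induced subgraphs.  (Decided by exhaustive search.)
discIso : {n : ℕ} → ℕ → Graph n → Fin n → Graph n → Fin n → Bool
discIso {n} k G v H u =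
  any (λ f → any (λ g →
      ⌊ lookup f v Fin.≟ u ⌋
    ∧ all (λ w → not (inV w) ∨ (inU (lookup f w) ∧ ⌊ lookup g (lookup f w) Fin.≟ w ⌋)) (allFin n)
    ∧ all (λ w → not (inU w) ∨ (inV (lookup g w) ∧ ⌊ lookup f (lookup g w) Fin.≟ w ⌋)) (allFin n)
    ∧ all (λ w₁ → all (λ w₂ → not (inV w₁ ∧ inV w₂)
                              ∨ not (adj G w₁ w₂ xor adj H (lookup f w₁) (lookup f w₂)))
                  (allFin n)) (allFin n))
    (allVecs n n)) (allVecs n n)
  where
    inV = within G k v
    inU = within H k u

discCount : {n : ℕ} → ℕ → Graph n → Graph n → Fin n → ℕ
discCount k G H x = countV (λ v → discIso k G v H x)

-- entry of freq_k(G) at the isomorphism type of the k-disc of H at x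
freqAt : {n : ℕ} .{{_ : NonZero n}} → ℕ → Graph n → Graph n → Fin n → ℚ
freqAt {n} k G H x = + discCount k G H x / n

-- Only types occurring in G₁ or G₂ have a nonzero entry;
-- each such type is counted exactly once via a canonical representative: the first vertex
-- of G₁ (in the order of Fin n) with that type, or, if none exists in G₁, the first
-- vertex of G₂ with that type.
l1FreqDist : {n : ℕ} .{{_ : NonZero n}} → ℕ → Graph n → Graph n → ℚ
l1FreqDist {n} k G₁ G₂ =
  sumQ (map (λ x → if repG₁ x then term G₁ x else 0ℚ) (allFin n))
  + sumQ (map (λ x → if repG₂ x then term G₂ x else 0ℚ) (allFin n))
  where
    sumQ : List ℚ → ℚ
    sumQ = foldr _+_ 0ℚ
    term : Graph n → Fin n → ℚ
    term H x = ∣ freqAt k G₁ H x - freqAt k G₂ H x ∣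
    repG₁ : Fin n → Bool
    repG₁ x = not (any (λ y → ⌊ y Fin.<? x ⌋ ∧ discIso k G₁ y G₁ x) (allFin n))
    repG₂ : Fin n → Bool
    repG₂ x = not (any (λ y → discIso k G₁ y G₂ x) (allFin n))
            ∧ not (any (λ y → ⌊ y Fin.<? x ⌋ ∧ discIso k G₂ y G₂ x) (allFin n))

module Submission where

-- Call a vertex changed if its k-discs in G₁ and G₂ are not isomorphic. For each disc
-- type, the numbers of vertices of that type in G₁ and in G₂ differ by at most the
-- number of changed vertices having that type in G₁ or in G₂; as a vertex has a single
-- type in each graph, summing over types gives n ‖freq_k G₁ − freq_k G₂‖₁ ≤ 2 #changed.
-- Inserting an edge ab only changes the discs of vertices within distance k of a or b,
-- and since a and b have degree at most d − 1 before the insertion, each of these two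
-- balls has at most 1 + (d − 1)(1 + d + ⋯ + d^(k−1)) = d^k vertices. Going from
-- G₁ ∩ G₂ up to G₁ and up to G₂ one edge at a time gives #changed ≤ 2 d^k · editDist,
-- so the ℓ₁ distance is at most 4 ε d^(k+1).

open import Defs

module Discs where

  open import Data.Bool using (Bool; true; false; _∧_; _∨_; not; if_then_else_; _xor_)
  open import Data.Bool.Properties as BoolP using (T-≡)
  open import Data.Bool.ListAction using (all; any)
  open import Data.Empty using (⊥; ⊥-elim)
  open import Data.Fin as Fin using (Fin; zero; suc)
  open import Data.Fin.Properties as FinP using ()
  open import Data.List using (map; allFin; foldr; tabulate)
  open import Data.List.Membership.Propositional using (_∈_; lose)
  open import Data.List.Membership.Propositional.Properties using (∈-allFin; ∈-map⁺; ∈-concatMap⁺)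
  open import Data.List.Relation.Unary.Any using (here; satisfied)
  open import Data.List.Relation.Unary.Any.Properties using (any⁺; any⁻)
  open import Data.Nat as ℕ using (ℕ; zero; suc; _+_; _*_; _≤_; _<_; z≤n; s≤s; _∸_; _^_; ∣_-_∣)
  open import Data.Nat.Properties as ℕP using ()
  open import Data.Nat.Solver using (module +-*-Solver)
  open import Data.Product using (∃; _×_; _,_; proj₁; proj₂)
  open import Data.Sum as ⊎ using (_⊎_; inj₁; inj₂)
  open import Data.Vec as Vec using (Vec; lookup)
  open import Data.Vec.Properties as VecP using ()
  open import Function using (_∘_; id; Equivalence)
  open import Relation.Binary.Definitions using (tri<; tri≈; tri>)
  open import Relation.Binary.PropositionalEquality
  open import Relation.Nullary using (¬_; yes; no)
  open import Relation.Nullary.Decidable using (⌊_⌋; _×-dec_; toWitness; isYes≗does; dec-true)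
  open import Algebra.Properties.CommutativeSemigroup ℕP.+-commutativeSemigroup
    using () renaming (interchange to +-interchange)
  open import Algebra.Properties.Semiring.Sum ℕP.+-*-semiring
    using (sum; sum-cong-≗; ∑-distrib-+; ∑-comm; *-distribˡ-sum; *-distribʳ-sum)
  open +-*-Solver using (solve; _:+_; _:*_; _:=_; con)
  open Equivalence using (to; from)

  private
    variable
      n : ℕ
      a b : Bool

  ∧-true⁻ˡ : a ∧ b ≡ true → a ≡ true
  ∧-true⁻ˡ {true} _ = refl

  ∧-true⁻ʳ : a ∧ b ≡ true → b ≡ true
  ∧-true⁻ʳ {true} h = h

  ∧-true⁺ : a ≡ true → b ≡ true → a ∧ b ≡ true
  ∧-true⁺ refl refl = refl

  ∨-true⁻ : a ∨ b ≡ true → a ≡ true ⊎ b ≡ true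
  ∨-true⁻ {true}  _ = inj₁ refl
  ∨-true⁻ {false} h = inj₂ h

  ∨-true⁺ˡ : a ≡ true → a ∨ b ≡ true
  ∨-true⁺ˡ refl = refl

  ∨-true⁺ʳ : b ≡ true → a ∨ b ≡ true
  ∨-true⁺ʳ {a = true}  _ = refl
  ∨-true⁺ʳ {a = false} h = h

  not-∨-true⁻ : not a ∨ b ≡ true → a ≡ true → b ≡ true
  not-∨-true⁻ h refl = h

  not-∨-true⁺ : (a ≡ true → b ≡ true) → not a ∨ b ≡ true
  not-∨-true⁺ {true}  f = f refl
  not-∨-true⁺ {false} _ = refl

  not-xor-true⁻ : not (a xor b) ≡ true → a ≡ b
  not-xor-true⁻ {true}  {true}  _ = refl
  not-xor-true⁻ {false} {false} _ = refl

  not-xor-true⁺ : a ≡ b → not (a xor b) ≡ true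
  not-xor-true⁺ {true}  refl = refl
  not-xor-true⁺ {false} refl = refl

  not-true⁻ : not a ≡ true → a ≡ false
  not-true⁻ {false} _ = refl

  xor-true-⊆ : (a ≡ true → b ≡ true) → a xor b ≡ true → a ≡ false × b ≡ true
  xor-true-⊆ {false} _   b≡true = refl , b≡true
  xor-true-⊆ {true}  a⇒b h with () ← trans (sym (cong not (a⇒b refl))) h

  ∧-false⁻ : a ≡ true → a ∧ b ≡ false → b ≡ false
  ∧-false⁻ refl h = h

  xor-false⁻ : a xor b ≡ false → a ≡ b
  xor-false⁻ {true}  {true}  _ = refl
  xor-false⁻ {false} {false} _ = refl

  not-false⁻ : not a ≡ false → a ≡ true
  not-false⁻ {true} _ = refl

  true≢false : a ≡ true → a ≡ false → ⊥
  true≢false refl ()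

  true⇒true-contra : (a ≡ true → b ≡ true) → b ≡ false → a ≡ false
  true⇒true-contra {false} _ _  = refl
  true⇒true-contra {true}  f b≡false = ⊥-elim (true≢false (f refl) b≡false)

  true⇔true⇒≡ : (a ≡ true → b ≡ true) → (b ≡ true → a ≡ true) → a ≡ b
  true⇔true⇒≡ {false} {false} _ _ = refl
  true⇔true⇒≡ {false} {true}  _ g = g refl
  true⇔true⇒≡ {true}          f _ = sym (f refl)

  ≟-true⁻ : {x y : Fin n} → ⌊ x Fin.≟ y ⌋ ≡ true → x ≡ y
  ≟-true⁻ {x = x} {y} h = toWitness {a? = x Fin.≟ y} (from T-≡ h)

  ≟-true⁺ : {x y : Fin n} → x ≡ y → ⌊ x Fin.≟ y ⌋ ≡ true
  ≟-true⁺ {x = x} {y} x≡y = trans (isYes≗does (x Fin.≟ y)) (dec-true (x Fin.≟ y) x≡y)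

  <?-true⁻ : {x y : Fin n} → ⌊ x Fin.<? y ⌋ ≡ true → x Fin.< y
  <?-true⁻ {x = x} {y} h = toWitness {a? = x Fin.<? y} (from T-≡ h)

  <?-true⁺ : {x y : Fin n} → x Fin.< y → ⌊ x Fin.<? y ⌋ ≡ true
  <?-true⁺ {x = x} {y} x<y = trans (isYes≗does (x Fin.<? y)) (dec-true (x Fin.<? y) x<y)

  any-allFin⁻ : (p : Fin n → Bool) → any p (allFin n) ≡ true → ∃ λ i → p i ≡ true
  any-allFin⁻ {n} p h with i , pi ← satisfied (any⁻ p (allFin n) (from T-≡ h)) = i , to T-≡ pi

  any-allFin⁺ : (p : Fin n → Bool) (i : Fin n) → p i ≡ true → any p (allFin n) ≡ true
  any-allFin⁺ {n} p i pi = to T-≡ (any⁺ {xs = allFin n} p (lose (∈-allFin i) (from T-≡ pi)))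

  any-allFin-false⁻ : (p : Fin n → Bool) → any p (allFin n) ≡ false → ∀ i → p i ≡ false
  any-allFin-false⁻ p h i with p i in pi
  ... | true  = ⊥-elim (true≢false (any-allFin⁺ p i pi) h)
  ... | false = refl

  all-tabulate⁻ : ∀ {A : Set} (g : Fin n → A) (p : A → Bool) →
                  all p (tabulate g) ≡ true → ∀ i → p (g i) ≡ true
  all-tabulate⁻ g p h zero    = ∧-true⁻ˡ h
  all-tabulate⁻ g p h (suc i) = all-tabulate⁻ (g ∘ suc) p (∧-true⁻ʳ {p (g zero)} h) i

  all-tabulate⁺ : ∀ {A : Set} (g : Fin n → A) (p : A → Bool) →
                  (∀ i → p (g i) ≡ true) → all p (tabulate g) ≡ true
  all-tabulate⁺ {zero}  g p h = refl
  all-tabulate⁺ {suc n} g p h = ∧-true⁺ (h zero) (all-tabulate⁺ (g ∘ suc) p (h ∘ suc))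

  ∈-allVecs : ∀ {m} (v : Vec (Fin n) m) → v ∈ allVecs n m
  ∈-allVecs Vec.[]       = here refl
  ∈-allVecs {n} {suc m} (x Vec.∷ v) =
    ∈-concatMap⁺ (λ y → map (y Vec.∷_) (allVecs n m)) (lose (∈-allFin x) (∈-map⁺ (x Vec.∷_) (∈-allVecs v)))

  any-allVecs⁺ : ∀ {m} (p : Vec (Fin n) m → Bool) v → p v ≡ true → any p (allVecs n m) ≡ true
  any-allVecs⁺ {n} {m} p v pv = to T-≡ (any⁺ {xs = allVecs n m} p (lose (∈-allVecs v) (from T-≡ pv)))

  any-allVecs⁻ : ∀ {m} (p : Vec (Fin n) m → Bool) → any p (allVecs n m) ≡ true → ∃ λ v → p v ≡ true
  any-allVecs⁻ {n} {m} p h with v , pv ← satisfied (any⁻ p (allVecs n m) (from T-≡ h)) = v , to T-≡ pv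

  ∣m-n∣≤a+b : ∀ {m n a b} → m ≤ n + a → n ≤ m + b → ∣ m - n ∣ ≤ a + b
  ∣m-n∣≤a+b {m} {n} {a} {b} m≤n+a n≤m+b with ℕP.≤-total m n
  ... | inj₁ m≤n = begin
    ∣ m - n ∣ ≡⟨ ℕP.m≤n⇒∣m-n∣≡n∸m m≤n ⟩
    n ∸ m     ≤⟨ ℕP.m≤n+o⇒m∸n≤o n m n≤m+b ⟩
    b         ≤⟨ ℕP.m≤n+m b a ⟩
    a + b     ∎
    where open ℕP.≤-Reasoning
  ... | inj₂ n≤m = begin
    ∣ m - n ∣ ≡⟨ ℕP.m≤n⇒∣n-m∣≡n∸m n≤m ⟩
    m ∸ n     ≤⟨ ℕP.m≤n+o⇒m∸n≤o m n m≤n+a ⟩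
    a         ≤⟨ ℕP.m≤m+n a b ⟩
    a + b     ∎
    where open ℕP.≤-Reasoning

  𝟙 : Bool → ℕ
  𝟙 true  = 1
  𝟙 false = 0

  𝟙≤1 : ∀ b → 𝟙 b ≤ 1
  𝟙≤1 true  = s≤s z≤n
  𝟙≤1 false = z≤n

  1≤𝟙 : a ≡ true → 1 ≤ 𝟙 a
  1≤𝟙 refl = s≤s z≤n

  𝟙≡0⁻ : 𝟙 a ≡ 0 → a ≡ false
  𝟙≡0⁻ {false} _ = refl

  𝟙>0⁻ : 0 < 𝟙 a → a ≡ true
  𝟙>0⁻ {true} _ = refl

  𝟙-∧ : ∀ a b → 𝟙 (a ∧ b) ≡ 𝟙 a * 𝟙 b
  𝟙-∧ true  b = sym (ℕP.+-identityʳ (𝟙 b))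
  𝟙-∧ false b = refl

  count-tabulate : ∀ {A : Set} (g : Fin n → A) (p : A → Bool) →
                   foldr (λ v acc → if p v then suc acc else acc) 0 (tabulate g) ≡ sum (𝟙 ∘ p ∘ g)
  count-tabulate {zero}  g p = refl
  count-tabulate {suc n} g p with p (g zero)
  ... | true  = cong suc (count-tabulate (g ∘ suc) p)
  ... | false = count-tabulate (g ∘ suc) p

  countV≡sum : (p : Fin n → Bool) → countV p ≡ sum (𝟙 ∘ p)
  countV≡sum = count-tabulate id

  foldr-+-map-tabulate : ∀ {A : Set} (g : Fin n → A) (f : A → ℕ) →
                         foldr _+_ 0 (map f (tabulate g)) ≡ sum (f ∘ g)
  foldr-+-map-tabulate {zero}  g f = refl
  foldr-+-map-tabulate {suc n} g f = cong (f (g zero) +_) (foldr-+-map-tabulate (g ∘ suc) f)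

  sum-mono-≤ : {f g : Fin n → ℕ} → (∀ i → f i ≤ g i) → sum f ≤ sum g
  sum-mono-≤ {zero}  f≤g = z≤n
  sum-mono-≤ {suc n} f≤g = ℕP.+-mono-≤ (f≤g zero) (sum-mono-≤ (f≤g ∘ suc))

  term≤sum : (f : Fin n → ℕ) (i : Fin n) → f i ≤ sum f
  term≤sum f zero    = ℕP.m≤m+n (f zero) _
  term≤sum f (suc i) = ℕP.≤-trans (term≤sum (f ∘ suc) i) (ℕP.m≤n+m _ (f zero))

  sum-zero : {f : Fin n → ℕ} → (∀ i → f i ≡ 0) → sum f ≡ 0
  sum-zero {zero}  f≡0 = refl
  sum-zero {suc n} f≡0 = cong₂ _+_ (f≡0 zero) (sum-zero (f≡0 ∘ suc))

  sum≡0⇒≡0 : (f : Fin n → ℕ) → sum f ≡ 0 → ∀ i → f i ≡ 0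
  sum≡0⇒≡0 f h zero    = ℕP.m+n≡0⇒m≡0 (f zero) h
  sum≡0⇒≡0 f h (suc i) = sum≡0⇒≡0 (f ∘ suc) (ℕP.m+n≡0⇒n≡0 (f zero) h) i

  sum>0⇒∃>0 : (f : Fin n → ℕ) → 0 < sum f → ∃ λ i → 0 < f i
  sum>0⇒∃>0 {suc n} f h with f zero in f₀
  ... | suc _ = zero , subst (0 <_) (sym f₀) (s≤s z≤n)
  ... | zero  with i , fi>0 ← sum>0⇒∃>0 (f ∘ suc) h = suc i , fi>0

  sum-𝟙-≤1 : (p : Fin n → Bool) → (∀ i j → p i ≡ true → p j ≡ true → i ≡ j) → sum (𝟙 ∘ p) ≤ 1
  sum-𝟙-≤1 {zero}  p unique = z≤n
  sum-𝟙-≤1 {suc n} p unique with p zero in p₀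
  ... | true  = s≤s (ℕP.≤-reflexive (sum-zero rest≡0))
    where
    rest≡0 : ∀ i → 𝟙 (p (suc i)) ≡ 0
    rest≡0 i with p (suc i) in pᵢ
    ... | true  with () ← unique zero (suc i) p₀ pᵢ
    ... | false = refl
  ... | false = sum-𝟙-≤1 (p ∘ suc) (λ i j pi pj → FinP.suc-injective (unique (suc i) (suc j) pi pj))

  sum-𝟙-≟ : (x : Fin n) → sum (λ w → 𝟙 ⌊ w Fin.≟ x ⌋) ≡ 1
  sum-𝟙-≟ x = ℕP.≤-antisym
    (sum-𝟙-≤1 (λ w → ⌊ w Fin.≟ x ⌋) (λ i j i≡x j≡x → trans (≟-true⁻ i≡x) (sym (≟-true⁻ j≡x))))
    (subst (_≤ sum (λ w → 𝟙 ⌊ w Fin.≟ x ⌋)) (cong 𝟙 (≟-true⁺ {x = x} refl)) (term≤sum _ x))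

  -- Distances

  _⊆ᴳ_ : Graph n → Graph n → Set
  G ⊆ᴳ H = ∀ x y → adj G x y ≡ true → adj H x y ≡ true

  module _ (G : Graph n) where

    within-refl : ∀ j v → within G j v v ≡ true
    within-refl zero    v = ≟-true⁺ refl
    within-refl (suc j) v = ∨-true⁺ˡ (within-refl j v)

    within-suc : ∀ j u v → within G j u v ≡ true → within G (suc j) u v ≡ true
    within-suc j u v = ∨-true⁺ˡ

    within-adj : ∀ j u x v → within G j u x ≡ true → adj G x v ≡ true → within G (suc j) u v ≡ true
    within-adj j u x v ux xv = ∨-true⁺ʳ (any-allFin⁺ _ x (∧-true⁺ ux xv))

    within-sucˡ⁻ : ∀ j u v → within G (suc j) u v ≡ true →
                   within G j u v ≡ true ⊎ ∃ λ x → within G j u x ≡ true × adj G x v ≡ true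
    within-sucˡ⁻ j u v h with ∨-true⁻ h
    ... | inj₁ uv = inj₁ uv
    ... | inj₂ ∃x with x , ux∧xv ← any-allFin⁻ _ ∃x = inj₂ (x , ∧-true⁻ˡ ux∧xv , ∧-true⁻ʳ {within G j u x} ux∧xv)

    within-suc⁻ : ∀ j u v → within G (suc j) u v ≡ true →
                  u ≡ v ⊎ ∃ λ x → within G j u x ≡ true × adj G x v ≡ true
    within-suc⁻ zero    u v h with within-sucˡ⁻ zero u v h
    ... | inj₁ uv = inj₁ (≟-true⁻ uv)
    ... | inj₂ step = inj₂ step
    within-suc⁻ (suc j) u v h with within-sucˡ⁻ (suc j) u v h
    ... | inj₂ step = inj₂ step
    ... | inj₁ uv with within-suc⁻ j u v uv
    ...   | inj₁ u≡v = inj₁ u≡v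
    ...   | inj₂ (x , ux , xv) = inj₂ (x , within-suc j u x ux , xv)

  within-mono-⊆ : {G H : Graph n} → G ⊆ᴳ H → ∀ j u v → within G j u v ≡ true → within H j u v ≡ true
  within-mono-⊆ G⊆H zero    u v h = h
  within-mono-⊆ {G = G} {H} G⊆H (suc j) u v h with within-suc⁻ G j u v h
  ... | inj₁ refl = within-refl H (suc j) u
  ... | inj₂ (x , ux , xv) = within-adj H j u x v (within-mono-⊆ G⊆H j u x ux) (G⊆H x v xv)

  -- Rooted isomorphisms of discs

  record IsDiscIso (k : ℕ) (G : Graph n) (v : Fin n) (H : Graph n) (u : Fin n)
                   (f g : Vec (Fin n) n) : Set where
    field
      root  : lookup f v ≡ u
      forth : ∀ w → within G k v w ≡ true →
              within H k u (lookup f w) ≡ true × lookup g (lookup f w) ≡ w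
      back  : ∀ w → within H k u w ≡ true →
              within G k v (lookup g w) ≡ true × lookup f (lookup g w) ≡ w
      adj-≡ : ∀ w₁ w₂ → within G k v w₁ ≡ true → within G k v w₂ ≡ true →
              adj G w₁ w₂ ≡ adj H (lookup f w₁) (lookup f w₂)

  module _ {k : ℕ} {G : Graph n} {v : Fin n} {H : Graph n} {u : Fin n} where

    private
      inV inU : Fin n → Bool
      inV = within G k v
      inU = within H k u

      rootᵇ : Vec (Fin n) n → Bool
      rootᵇ f = ⌊ lookup f v Fin.≟ u ⌋

      forthᵇ backᵇ : Vec (Fin n) n → Vec (Fin n) n → Fin n → Bool
      forthᵇ f g w = not (inV w) ∨ (inU (lookup f w) ∧ ⌊ lookup g (lookup f w) Fin.≟ w ⌋)
      backᵇ  f g w = not (inU w) ∨ (inV (lookup g w) ∧ ⌊ lookup f (lookup g w) Fin.≟ w ⌋)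

      adjᵇ : Vec (Fin n) n → Fin n → Fin n → Bool
      adjᵇ f w₁ w₂ = not (inV w₁ ∧ inV w₂) ∨ not (adj G w₁ w₂ xor adj H (lookup f w₁) (lookup f w₂))

      allᵇ : (Fin n → Bool) → Bool
      allᵇ p = all p (allFin n)

    discIso⁻ : discIso k G v H u ≡ true → ∃ λ f → ∃ λ g → IsDiscIso k G v H u f g
    discIso⁻ h with any-allVecs⁻ _ h
    ... | f , ∃g with any-allVecs⁻ _ ∃g
    ... | g , conds = f , g , record
      { root  = ≟-true⁻ (∧-true⁻ˡ conds)
      ; forth = λ w vw → let q = not-∨-true⁻ (all-tabulate⁻ id (forthᵇ f g) forth-ok w) vw
                         in ∧-true⁻ˡ q , ≟-true⁻ (∧-true⁻ʳ {inU (lookup f w)} q)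
      ; back  = λ w uw → let q = not-∨-true⁻ (all-tabulate⁻ id (backᵇ f g) back-ok w) uw
                         in ∧-true⁻ˡ q , ≟-true⁻ (∧-true⁻ʳ {inV (lookup g w)} q)
      ; adj-≡ = λ w₁ w₂ vw₁ vw₂ → not-xor-true⁻ (not-∨-true⁻
          (all-tabulate⁻ id (adjᵇ f w₁) (all-tabulate⁻ id (allᵇ ∘ adjᵇ f) adj-ok w₁) w₂)
          (∧-true⁺ vw₁ vw₂))
      }
      where
      rest₁ : allᵇ (forthᵇ f g) ∧ allᵇ (backᵇ f g) ∧ allᵇ (allᵇ ∘ adjᵇ f) ≡ true
      rest₁ = ∧-true⁻ʳ {rootᵇ f} conds
      rest₂ : allᵇ (backᵇ f g) ∧ allᵇ (allᵇ ∘ adjᵇ f) ≡ true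
      rest₂ = ∧-true⁻ʳ {allᵇ (forthᵇ f g)} rest₁
      forth-ok : allᵇ (forthᵇ f g) ≡ true
      forth-ok = ∧-true⁻ˡ rest₁
      back-ok : allᵇ (backᵇ f g) ≡ true
      back-ok = ∧-true⁻ˡ rest₂
      adj-ok : allᵇ (allᵇ ∘ adjᵇ f) ≡ true
      adj-ok = ∧-true⁻ʳ {allᵇ (backᵇ f g)} rest₂

    discIso⁺ : ∀ {f g} → IsDiscIso k G v H u f g → discIso k G v H u ≡ true
    discIso⁺ {f} {g} iso = any-allVecs⁺ _ f (any-allVecs⁺ _ g
      (∧-true⁺ (≟-true⁺ root) (∧-true⁺
        (all-tabulate⁺ id _ (λ w → not-∨-true⁺ λ vw →
          ∧-true⁺ (proj₁ (forth w vw)) (≟-true⁺ (proj₂ (forth w vw))))) (∧-true⁺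
        (all-tabulate⁺ id _ (λ w → not-∨-true⁺ λ uw →
          ∧-true⁺ (proj₁ (back w uw)) (≟-true⁺ (proj₂ (back w uw)))))
        (all-tabulate⁺ id _ (λ w₁ → all-tabulate⁺ id _ (λ w₂ → not-∨-true⁺ λ vw →
          not-xor-true⁺ (adj-≡ w₁ w₂ (∧-true⁻ˡ vw) (∧-true⁻ʳ {inV w₁} vw)))))))))
      where open IsDiscIso iso

  module _ {k : ℕ} where

    IsDiscIso-sym : ∀ {G v H u f g} → IsDiscIso {n} k G v H u f g → IsDiscIso k H u G v g f
    IsDiscIso-sym {G = G} {v} {H} {u} {f} {g} iso = record
      { root  = subst (λ z → lookup g z ≡ v) root (proj₂ (forth v (within-refl G k v)))
      ; forth = back
      ; back  = forth
      ; adj-≡ = λ w₁ w₂ uw₁ uw₂ →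
          let (vw₁ , fgw₁) = back w₁ uw₁ ; (vw₂ , fgw₂) = back w₂ uw₂ in
          sym (trans (adj-≡ (lookup g w₁) (lookup g w₂) vw₁ vw₂) (cong₂ (adj H) fgw₁ fgw₂))
      }
      where open IsDiscIso iso

    IsDiscIso-trans : ∀ {G₁ v₁ G₂ v₂ G₃ v₃ f g f′ g′} →
                      IsDiscIso {n} k G₁ v₁ G₂ v₂ f g → IsDiscIso k G₂ v₂ G₃ v₃ f′ g′ →
                      IsDiscIso k G₁ v₁ G₃ v₃ (Vec.map (lookup f′) f) (Vec.map (lookup g) g′)
    IsDiscIso-trans {n} {G₁ = G₁} {v₁} {G₂} {v₂} {G₃} {v₃} {f} {g} {f′} {g′} P Q = record
      { root  = trans (lookup-f″ v₁) (trans (cong (lookup f′) P.root) Q.root)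
      ; forth = λ w w∈ →
          let (fw∈ , gfw) = P.forth w w∈ ; (f′fw∈ , g′f′fw) = Q.forth (lookup f w) fw∈ in
          subst (λ z → within G₃ k v₃ z ≡ true) (sym (lookup-f″ w)) f′fw∈ ,
          (begin
            lookup g″ (lookup f″ w)           ≡⟨ cong (lookup g″) (lookup-f″ w) ⟩
            lookup g″ (lookup f′ (lookup f w)) ≡⟨ lookup-g″ _ ⟩
            lookup g (lookup g′ (lookup f′ (lookup f w))) ≡⟨ cong (lookup g) g′f′fw ⟩
            lookup g (lookup f w)             ≡⟨ gfw ⟩
            w                                 ∎)
      ; back  = λ w w∈ →
          let (g′w∈ , f′g′w) = Q.back w w∈ ; (gg′w∈ , fgg′w) = P.back (lookup g′ w) g′w∈ in
          subst (λ z → within G₁ k v₁ z ≡ true) (sym (lookup-g″ w)) gg′w∈ ,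
          (begin
            lookup f″ (lookup g″ w)            ≡⟨ cong (lookup f″) (lookup-g″ w) ⟩
            lookup f″ (lookup g (lookup g′ w)) ≡⟨ lookup-f″ _ ⟩
            lookup f′ (lookup f (lookup g (lookup g′ w))) ≡⟨ cong (lookup f′) fgg′w ⟩
            lookup f′ (lookup g′ w)            ≡⟨ f′g′w ⟩
            w                                  ∎)
      ; adj-≡ = λ w₁ w₂ w₁∈ w₂∈ → begin
          adj G₁ w₁ w₂                             ≡⟨ P.adj-≡ w₁ w₂ w₁∈ w₂∈ ⟩
          adj G₂ (lookup f w₁) (lookup f w₂)
            ≡⟨ Q.adj-≡ _ _ (proj₁ (P.forth w₁ w₁∈)) (proj₁ (P.forth w₂ w₂∈)) ⟩
          adj G₃ (lookup f′ (lookup f w₁)) (lookup f′ (lookup f w₂))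
            ≡⟨ sym (cong₂ (adj G₃) (lookup-f″ w₁) (lookup-f″ w₂)) ⟩
          adj G₃ (lookup f″ w₁) (lookup f″ w₂)     ∎
      }
      where
      open ≡-Reasoning
      module P = IsDiscIso P
      module Q = IsDiscIso Q
      f″ g″ : Vec (Fin n) n
      f″ = Vec.map (lookup f′) f
      g″ = Vec.map (lookup g) g′
      lookup-f″ : ∀ w → lookup f″ w ≡ lookup f′ (lookup f w)
      lookup-f″ w = VecP.lookup-map w (lookup f′) f
      lookup-g″ : ∀ w → lookup g″ w ≡ lookup g (lookup g′ w)
      lookup-g″ w = VecP.lookup-map w (lookup g) g′

  module _ (k : ℕ) where

    discIso-sym : ∀ G v H u → discIso {n} k G v H u ≡ true → discIso k H u G v ≡ true
    discIso-sym G v H u h = let _ , _ , iso = discIso⁻ {k = k} {G} {v} {H} {u} h in discIso⁺ (IsDiscIso-sym iso)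

    discIso-trans : ∀ G₁ v₁ G₂ v₂ G₃ v₃ → discIso {n} k G₁ v₁ G₂ v₂ ≡ true →
                    discIso k G₂ v₂ G₃ v₃ ≡ true → discIso k G₁ v₁ G₃ v₃ ≡ true
    discIso-trans G₁ v₁ G₂ v₂ G₃ v₃ h₁ h₂ =
      let _ , _ , P = discIso⁻ {k = k} {G₁} {v₁} {G₂} {v₂} h₁
          _ , _ , Q = discIso⁻ {k = k} {G₂} {v₂} {G₃} {v₃} h₂
      in discIso⁺ (IsDiscIso-trans P Q)

  record SameDisc (k : ℕ) (G H : Graph n) (w : Fin n) : Set where
    field
      same-ball : ∀ z → within G k w z ≡ within H k w z
      same-adj  : ∀ z₁ z₂ → within G k w z₁ ≡ true → within G k w z₂ ≡ true → adj G z₁ z₂ ≡ adj H z₁ z₂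

  SameDisc⇒discIso : ∀ {k} {G H : Graph n} {w} → SameDisc k G H w → discIso k G w H w ≡ true
  SameDisc⇒discIso {n} {k} {G} {H} {w} same = discIso⁺ {k = k} {G} {w} {H} {w} {idᵛ} {idᵛ} record
    { root  = lookup-id w
    ; forth = λ z z∈ → subst (λ y → within H k w y ≡ true) (sym (lookup-id z)) (trans (sym (ball-≡ z)) z∈) ,
                       lookup-id²
    ; back  = λ z z∈ → subst (λ y → within G k w y ≡ true) (sym (lookup-id z)) (trans (ball-≡ z) z∈) ,
                       lookup-id²
    ; adj-≡ = λ z₁ z₂ z₁∈ z₂∈ → trans (adj-≡′ z₁ z₂ z₁∈ z₂∈) (sym (cong₂ (adj H) (lookup-id z₁) (lookup-id z₂)))
    }
    where
    idᵛ : Vec (Fin n) n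
    idᵛ = Vec.allFin n
    lookup-id : ∀ z → lookup idᵛ z ≡ z
    lookup-id = VecP.lookup-allFin
    lookup-id² : ∀ {z} → lookup idᵛ (lookup idᵛ z) ≡ z
    lookup-id² {z} = trans (lookup-id _) (lookup-id z)
    open SameDisc same renaming (same-ball to ball-≡; same-adj to adj-≡′)

  -- Counting disc types

  module _ (k : ℕ) where

    discChanged : Graph n → Graph n → Fin n → Bool
    discChanged G H w = not (discIso k G w H w)

    discChanges : Graph n → Graph n → ℕ
    discChanges G H = sum (𝟙 ∘ discChanged G H)

    typeCount : Graph n → Graph n → Fin n → ℕ
    typeCount K H x = sum (λ w → 𝟙 (discIso k K w H x))

    firstOfType : Graph n → Fin n → Bool
    firstOfType {n} G x = not (any (λ y → ⌊ y Fin.<? x ⌋ ∧ discIso k G y G x) (allFin n))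

    firstOfType⁻ : ∀ {G : Graph n} {x} → firstOfType G x ≡ true →
                   ∀ y → (⌊ y Fin.<? x ⌋ ∧ discIso k G y G x) ≡ false
    firstOfType⁻ first = any-allFin-false⁻ _ (not-true⁻ first)

    firstOfType-unique : ∀ {G : Graph n} {x y} → firstOfType G x ≡ true → firstOfType G y ≡ true →
                         discIso k G x G y ≡ true → x ≡ y
    firstOfType-unique {G = G} {x} {y} first-x first-y x≅y with FinP.<-cmp x y
    ... | tri≈ _ x≡y _ = x≡y
    ... | tri< x<y _ _ =
      ⊥-elim (true≢false (∧-true⁺ (<?-true⁺ x<y) x≅y) (firstOfType⁻ first-y x))
    ... | tri> _ _ y<x =
      ⊥-elim (true≢false (∧-true⁺ (<?-true⁺ y<x) (discIso-sym k G x G y x≅y)) (firstOfType⁻ first-x y))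

  module Discrepancy {n} (k : ℕ) (G₁ G₂ : Graph n) where

    changed : Fin n → Bool
    changed = discChanged k G₁ G₂

    -- definitionally the representatives repG₁ and repG₂ in l1FreqDist
    isRep₁ isRep₂ : Fin n → Bool
    isRep₁ x = firstOfType k G₁ x
    isRep₂ x = not (any (λ y → discIso k G₁ y G₂ x) (allFin n)) ∧ firstOfType k G₂ x

    changedOfType : Graph n → Graph n → Fin n → ℕ
    changedOfType K H x = sum (λ w → 𝟙 (changed w) * 𝟙 (discIso k K w H x))

    repHits : Graph n → Graph n → (Fin n → Bool) → Fin n → ℕ
    repHits K H isRep w = sum (λ x → 𝟙 (isRep x ∧ discIso k K w H x))

    unchanged⇒≅ : ∀ w → changed w ≡ false → discIso k G₁ w G₂ w ≡ true
    unchanged⇒≅ w = not-false⁻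

    typeCount-≤ : ∀ {K₁ K₂} → (∀ w → changed w ≡ false → discIso k K₁ w K₂ w ≡ true) →
                  ∀ H x → typeCount k K₁ H x ≤ typeCount k K₂ H x + changedOfType K₁ H x
    typeCount-≤ {K₁} {K₂} same⇒≅ H x = begin
      typeCount k K₁ H x                                      ≤⟨ sum-mono-≤ pointwise ⟩
      sum (λ w → 𝟙 (discIso k K₂ w H x) + 𝟙 (changed w) * 𝟙 (discIso k K₁ w H x))
        ≡⟨ ∑-distrib-+ (λ w → 𝟙 (discIso k K₂ w H x)) (λ w → 𝟙 (changed w) * 𝟙 (discIso k K₁ w H x)) ⟩
      typeCount k K₂ H x + changedOfType K₁ H x               ∎
      where
      open ℕP.≤-Reasoning
      pointwise : ∀ w → 𝟙 (discIso k K₁ w H x) ≤ 𝟙 (discIso k K₂ w H x) + 𝟙 (changed w) * 𝟙 (discIso k K₁ w H x)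
      pointwise w with discIso k K₁ w H x in w≅x | changed w in ch | discIso k K₂ w H x in w≅′x
      ... | false | _     | _     = z≤n
      ... | true  | true  | _     = ℕP.m≤n+m 1 _
      ... | true  | false | true  = s≤s z≤n
      ... | true  | false | false =
        ⊥-elim (true≢false (discIso-trans k K₂ w K₁ w H x (discIso-sym k K₁ w K₂ w (same⇒≅ w ch)) w≅x) w≅′x)

    ∣typeCount-typeCount∣≤ : ∀ H x → ∣ typeCount k G₁ H x - typeCount k G₂ H x ∣ ≤
                                     changedOfType G₁ H x + changedOfType G₂ H x
    ∣typeCount-typeCount∣≤ H x = ∣m-n∣≤a+b
      (typeCount-≤ unchanged⇒≅ H x)
      (typeCount-≤ (λ w ch → discIso-sym k G₁ w G₂ w (unchanged⇒≅ w ch)) H x)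

    uniqueRep : ∀ K w G (isRep : Fin n → Bool) → (∀ x → isRep x ≡ true → firstOfType k G x ≡ true) →
                ∀ x y → isRep x ∧ discIso k K w G x ≡ true → isRep y ∧ discIso k K w G y ≡ true → x ≡ y
    uniqueRep K w G isRep rep⇒first x y rep-x∧w≅x rep-y∧w≅y = firstOfType-unique k
      (rep⇒first x (∧-true⁻ˡ rep-x∧w≅x)) (rep⇒first y (∧-true⁻ˡ rep-y∧w≅y))
      (discIso-trans k G x K w G y (discIso-sym k K w G x (∧-true⁻ʳ {isRep x} rep-x∧w≅x))
                                   (∧-true⁻ʳ {isRep y} rep-y∧w≅y))

    -- a vertex has one disc type, and distinct representatives have distinct types
    repHits-≤1 : ∀ K w → repHits K G₁ isRep₁ w + repHits K G₂ isRep₂ w ≤ 1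
    repHits-≤1 K w with any (λ x → isRep₁ x ∧ discIso k K w G₁ x) (allFin n) in hit₁
    ... | true  = begin
      repHits K G₁ isRep₁ w + repHits K G₂ isRep₂ w ≡⟨ cong (repHits K G₁ isRep₁ w +_) (sum-zero no-hit₂) ⟩
      repHits K G₁ isRep₁ w + 0                     ≡⟨ ℕP.+-identityʳ _ ⟩
      repHits K G₁ isRep₁ w                         ≤⟨ sum-𝟙-≤1 _ (uniqueRep K w G₁ isRep₁ (λ _ → id)) ⟩
      1                                             ∎
      where
      open ℕP.≤-Reasoning
      no-hit₂ : ∀ y → 𝟙 (isRep₂ y ∧ discIso k K w G₂ y) ≡ 0
      no-hit₂ y with isRep₂ y in rep-y | discIso k K w G₂ y in w≅y
      ... | false | _     = refl
      ... | true  | false = refl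
      ... | true  | true  with x , rep-x∧w≅x ← any-allFin⁻ _ hit₁ =
        ⊥-elim (true≢false
          (discIso-trans k G₁ x K w G₂ y (discIso-sym k K w G₁ x (∧-true⁻ʳ {isRep₁ x} rep-x∧w≅x)) w≅y)
          (any-allFin-false⁻ _ (not-true⁻ (∧-true⁻ˡ rep-y)) x))
    ... | false = begin
      repHits K G₁ isRep₁ w + repHits K G₂ isRep₂ w ≡⟨ cong (_+ repHits K G₂ isRep₂ w) (sum-zero no-hit₁) ⟩
      repHits K G₂ isRep₂ w                         ≤⟨ sum-𝟙-≤1 _ (uniqueRep K w G₂ isRep₂ rep₂⇒first) ⟩
      1                                             ∎
      where
      open ℕP.≤-Reasoning
      no-hit₁ : ∀ x → 𝟙 (isRep₁ x ∧ discIso k K w G₁ x) ≡ 0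
      no-hit₁ x = cong 𝟙 (any-allFin-false⁻ _ hit₁ x)
      rep₂⇒first : ∀ x → isRep₂ x ≡ true → firstOfType k G₂ x ≡ true
      rep₂⇒first x = ∧-true⁻ʳ {not (any (λ y → discIso k G₁ y G₂ x) (allFin n))}

    sum-reps-changedOfType : ∀ K H (isRep : Fin n → Bool) →
      sum (λ x → 𝟙 (isRep x) * changedOfType K H x) ≡ sum (λ w → 𝟙 (changed w) * repHits K H isRep w)
    sum-reps-changedOfType K H isRep = begin
      sum (λ x → r x * changedOfType K H x)
        ≡⟨ sum-cong-≗ (λ x → *-distribˡ-sum (r x) (λ w → c w * 𝟙 (≅ x w))) ⟩
      sum (λ x → sum (λ w → r x * (c w * 𝟙 (≅ x w))))
        ≡⟨ sum-cong-≗ (λ x → sum-cong-≗ (λ w → 𝟙-rearrange (isRep x) (changed w) (≅ x w))) ⟩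
      sum (λ x → sum (λ w → c w * 𝟙 (isRep x ∧ ≅ x w)))
        ≡⟨ ∑-comm (λ x w → c w * 𝟙 (isRep x ∧ ≅ x w)) ⟩
      sum (λ w → sum (λ x → c w * 𝟙 (isRep x ∧ ≅ x w)))
        ≡⟨ sum-cong-≗ (λ w → sym (*-distribˡ-sum (c w) (λ x → 𝟙 (isRep x ∧ ≅ x w)))) ⟩
      sum (λ w → c w * repHits K H isRep w) ∎
      where
      open ≡-Reasoning
      r c : Fin n → ℕ
      r x = 𝟙 (isRep x)
      c w = 𝟙 (changed w)
      ≅ : Fin n → Fin n → Bool
      ≅ x w = discIso k K w H x
      𝟙-rearrange : ∀ a b d → 𝟙 a * (𝟙 b * 𝟙 d) ≡ 𝟙 b * 𝟙 (a ∧ d)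
      𝟙-rearrange true  b d = ℕP.*-identityˡ _
      𝟙-rearrange false b d = sym (ℕP.*-zeroʳ (𝟙 b))

    sum-reps-changedOfType-≤ : ∀ K →
      sum (λ x → 𝟙 (isRep₁ x) * changedOfType K G₁ x) + sum (λ x → 𝟙 (isRep₂ x) * changedOfType K G₂ x)
        ≤ discChanges k G₁ G₂
    sum-reps-changedOfType-≤ K = begin
      sum (λ x → 𝟙 (isRep₁ x) * changedOfType K G₁ x) + sum (λ x → 𝟙 (isRep₂ x) * changedOfType K G₂ x)
        ≡⟨ cong₂ _+_ (sum-reps-changedOfType K G₁ isRep₁) (sum-reps-changedOfType K G₂ isRep₂) ⟩
      sum (λ w → c w * hits₁ w) + sum (λ w → c w * hits₂ w)
        ≡⟨ sym (∑-distrib-+ (λ w → c w * hits₁ w) (λ w → c w * hits₂ w)) ⟩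
      sum (λ w → c w * hits₁ w + c w * hits₂ w)
        ≡⟨ sum-cong-≗ (λ w → sym (ℕP.*-distribˡ-+ (c w) (hits₁ w) (hits₂ w))) ⟩
      sum (λ w → c w * (hits₁ w + hits₂ w))
        ≤⟨ sum-mono-≤ (λ w → ℕP.*-monoʳ-≤ (c w) (repHits-≤1 K w)) ⟩
      sum (λ w → c w * 1)
        ≡⟨ sum-cong-≗ (λ w → ℕP.*-identityʳ (c w)) ⟩
      discChanges k G₁ G₂ ∎
      where
      open ℕP.≤-Reasoning
      c hits₁ hits₂ : Fin n → ℕ
      c w = 𝟙 (changed w)
      hits₁ = repHits K G₁ isRep₁
      hits₂ = repHits K G₂ isRep₂

    typeDiscrepancy : Graph n → (Fin n → Bool) → ℕ
    typeDiscrepancy H isRep = sum (λ x → 𝟙 (isRep x) * ∣ typeCount k G₁ H x - typeCount k G₂ H x ∣)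

    typeDiscrepancy-≤ : ∀ H isRep → typeDiscrepancy H isRep ≤
      sum (λ x → 𝟙 (isRep x) * changedOfType G₁ H x) + sum (λ x → 𝟙 (isRep x) * changedOfType G₂ H x)
    typeDiscrepancy-≤ H isRep = begin
      typeDiscrepancy H isRep
        ≤⟨ sum-mono-≤ (λ x → ℕP.*-monoʳ-≤ (r x) (∣typeCount-typeCount∣≤ H x)) ⟩
      sum (λ x → r x * (c₁ x + c₂ x))
        ≡⟨ sum-cong-≗ (λ x → ℕP.*-distribˡ-+ (r x) (c₁ x) (c₂ x)) ⟩
      sum (λ x → r x * c₁ x + r x * c₂ x)
        ≡⟨ ∑-distrib-+ (λ x → r x * c₁ x) (λ x → r x * c₂ x) ⟩
      sum (λ x → r x * c₁ x) + sum (λ x → r x * c₂ x) ∎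
      where
      open ℕP.≤-Reasoning
      r c₁ c₂ : Fin n → ℕ
      r x  = 𝟙 (isRep x)
      c₁ x = changedOfType G₁ H x
      c₂ x = changedOfType G₂ H x

    typeDiscrepancy-≤-changes : typeDiscrepancy G₁ isRep₁ + typeDiscrepancy G₂ isRep₂ ≤ 2 * discChanges k G₁ G₂
    typeDiscrepancy-≤-changes = begin
      typeDiscrepancy G₁ isRep₁ + typeDiscrepancy G₂ isRep₂
        ≤⟨ ℕP.+-mono-≤ (typeDiscrepancy-≤ G₁ isRep₁) (typeDiscrepancy-≤ G₂ isRep₂) ⟩
      (Σ₁ G₁ + Σ₁ G₂) + (Σ₂ G₁ + Σ₂ G₂)
        ≡⟨ +-interchange (Σ₁ G₁) (Σ₁ G₂) (Σ₂ G₁) (Σ₂ G₂) ⟩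
      (Σ₁ G₁ + Σ₂ G₁) + (Σ₁ G₂ + Σ₂ G₂)
        ≤⟨ ℕP.+-mono-≤ (sum-reps-changedOfType-≤ G₁) (sum-reps-changedOfType-≤ G₂) ⟩
      discChanges k G₁ G₂ + discChanges k G₁ G₂
        ≡⟨ cong (discChanges k G₁ G₂ +_) (sym (ℕP.+-identityʳ _)) ⟩
      2 * discChanges k G₁ G₂ ∎
      where
      open ℕP.≤-Reasoning
      Σ₁ Σ₂ : Graph n → ℕ
      Σ₁ K = sum (λ x → 𝟙 (isRep₁ x) * changedOfType K G₁ x)
      Σ₂ K = sum (λ x → 𝟙 (isRep₂ x) * changedOfType K G₂ x)

  -- Balls in graphs of bounded degree

  geomSum : ℕ → ℕ → ℕ
  geomSum d zero    = 1
  geomSum d (suc j) = 1 + d * geomSum d j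

  1+e*geomSum≡[1+e]^[1+j] : ∀ e j → 1 + e * geomSum (suc e) j ≡ suc e ^ suc j
  1+e*geomSum≡[1+e]^[1+j] e zero    = refl
  1+e*geomSum≡[1+e]^[1+j] e (suc j) = begin
    1 + e * (1 + suc e * geomSum (suc e) j)   ≡⟨ solve 2 (λ e g → con 1 :+ e :* (con 1 :+ (con 1 :+ e) :* g)
                                                             := (con 1 :+ e) :* (con 1 :+ e :* g)) refl e _ ⟩
    suc e * (1 + e * geomSum (suc e) j)       ≡⟨ cong (suc e *_) (1+e*geomSum≡[1+e]^[1+j] e j) ⟩
    suc e * suc e ^ suc j                     ∎
    where open ≡-Reasoning

  module _ (H : Graph n) where

    deg-mono-⊆ : ∀ {G} → G ⊆ᴳ H → ∀ x → deg G x ≤ deg H x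
    deg-mono-⊆ {G} G⊆H x = begin
      deg G x                   ≡⟨ countV≡sum (adj G x) ⟩
      sum (λ y → 𝟙 (adj G x y)) ≤⟨ sum-mono-≤ (λ y → 𝟙-mono (G⊆H x y)) ⟩
      sum (λ y → 𝟙 (adj H x y)) ≡⟨ countV≡sum (adj H x) ⟨
      deg H x                   ∎
      where
      open ℕP.≤-Reasoning
      𝟙-mono : ∀ {a b} → (a ≡ true → b ≡ true) → 𝟙 a ≤ 𝟙 b
      𝟙-mono {false} _ = z≤n
      𝟙-mono {true}  a⇒b = 1≤𝟙 (a⇒b refl)

    ballSize : ℕ → Fin n → ℕ
    ballSize j x = sum (λ w → 𝟙 (within H j w x))

    sum-adj≡deg : ∀ x → sum (λ y → 𝟙 (adj H y x)) ≡ deg H x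
    sum-adj≡deg x = trans (sum-cong-≗ (λ y → cong 𝟙 (adj-sym H y x))) (sym (countV≡sum (adj H x)))

    ballSize-suc : ∀ j x → ballSize (suc j) x ≤ 1 + sum (λ y → 𝟙 (adj H y x) * ballSize j y)
    ballSize-suc j x = begin
      ballSize (suc j) x                           ≤⟨ sum-mono-≤ pointwise ⟩
      sum (λ w → 𝟙 ⌊ w Fin.≟ x ⌋ + sum (λ y → step y w))
                                                   ≡⟨ ∑-distrib-+ (λ w → 𝟙 ⌊ w Fin.≟ x ⌋) (λ w → sum (λ y → step y w)) ⟩
      sum (λ w → 𝟙 ⌊ w Fin.≟ x ⌋) + sum (λ w → sum (λ y → step y w))
                                                   ≡⟨ cong₂ _+_ (sum-𝟙-≟ x) (∑-comm (λ w y → step y w)) ⟩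
      1 + sum (λ y → sum (λ w → step y w))         ≡⟨ cong suc (sum-cong-≗ (λ y →
                                                        sym (*-distribˡ-sum (𝟙 (adj H y x)) (λ w → 𝟙 (within H j w y))))) ⟩
      1 + sum (λ y → 𝟙 (adj H y x) * ballSize j y) ∎
      where
      open ℕP.≤-Reasoning
      step : Fin n → Fin n → ℕ
      step y w = 𝟙 (adj H y x) * 𝟙 (within H j w y)
      pointwise : ∀ w → 𝟙 (within H (suc j) w x) ≤ 𝟙 ⌊ w Fin.≟ x ⌋ + sum (λ y → step y w)
      pointwise w with within H (suc j) w x in wx
      ... | false = z≤n
      ... | true  with within-suc⁻ H j w x wx
      ...   | inj₁ refl = subst (λ b → 1 ≤ 𝟙 b + sum (λ y → step y w)) (sym (≟-true⁺ {x = w} refl)) (s≤s z≤n)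
      ...   | inj₂ (y , wy , yx) = ℕP.≤-trans
        (subst₂ (λ b c → 1 ≤ 𝟙 b * 𝟙 c) (sym yx) (sym wy) (s≤s z≤n))
        (ℕP.≤-trans (term≤sum (λ y → step y w) y) (ℕP.m≤n+m _ _))

    ballSize-suc-≤ : ∀ j x b → (∀ y → ballSize j y ≤ b) → ballSize (suc j) x ≤ 1 + deg H x * b
    ballSize-suc-≤ j x b ball≤b = begin
      ballSize (suc j) x                              ≤⟨ ballSize-suc j x ⟩
      1 + sum (λ y → 𝟙 (adj H y x) * ballSize j y)
        ≤⟨ s≤s (sum-mono-≤ (λ y → ℕP.*-monoʳ-≤ (𝟙 (adj H y x)) (ball≤b y))) ⟩
      1 + sum (λ y → 𝟙 (adj H y x) * b)               ≡⟨ cong suc (sym (*-distribʳ-sum b (λ y → 𝟙 (adj H y x)))) ⟩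
      1 + sum (λ y → 𝟙 (adj H y x)) * b               ≡⟨ cong (λ m → 1 + m * b) (sum-adj≡deg x) ⟩
      1 + deg H x * b                                 ∎
      where open ℕP.≤-Reasoning

    ballSize-≤-geomSum : ∀ {d} → Bounded d H → ∀ j x → ballSize j x ≤ geomSum d j
    ballSize-≤-geomSum bounded zero    x = ℕP.≤-reflexive (sum-𝟙-≟ x)
    ballSize-≤-geomSum {d} bounded (suc j) x = ℕP.≤-trans
      (ballSize-suc-≤ j x (geomSum d j) (ballSize-≤-geomSum bounded j))
      (s≤s (ℕP.*-monoˡ-≤ (geomSum d j) (bounded x)))

    ballSize-≤-^ : ∀ {e} → Bounded (suc e) H → ∀ {x} → deg H x ≤ e → ∀ j → ballSize j x ≤ suc e ^ j
    ballSize-≤-^ bounded {x} _ zero = ℕP.≤-reflexive (sum-𝟙-≟ x)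
    ballSize-≤-^ {e} bounded {x} deg≤e (suc j) = begin
      ballSize (suc j) x                ≤⟨ ballSize-suc-≤ j x (geomSum (suc e) j) (ballSize-≤-geomSum bounded j) ⟩
      1 + deg H x * geomSum (suc e) j   ≤⟨ s≤s (ℕP.*-monoˡ-≤ (geomSum (suc e) j) deg≤e) ⟩
      1 + e * geomSum (suc e) j         ≡⟨ 1+e*geomSum≡[1+e]^[1+j] e j ⟩
      suc e ^ suc j                     ∎
      where open ℕP.≤-Reasoning

  -- Adding a single edge

  record AddsEdge (H H′ : Graph n) (a b : Fin n) : Set where
    field
      ⊆H′   : H ⊆ᴳ H′
      added : adj H′ a b ≡ true
      fresh : adj H a b ≡ false
      only  : ∀ x y → adj H′ x y ≡ true → adj H x y ≡ true ⊎ (x ≡ a × y ≡ b) ⊎ (x ≡ b × y ≡ a)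

  AddsEdge-swap : ∀ {H H′ : Graph n} {a b} → AddsEdge H H′ a b → AddsEdge H H′ b a
  AddsEdge-swap {H = H} {H′} {a} {b} A = record
    { ⊆H′   = ⊆H′
    ; added = trans (adj-sym H′ b a) added
    ; fresh = trans (adj-sym H b a) fresh
    ; only  = λ x y xy → ⊎.map₂ ⊎.swap (only x y xy)
    }
    where open AddsEdge A

  module _ {H H′ : Graph n} {a b : Fin n} (A : AddsEdge H H′ a b) where
    open AddsEdge A

    within-avoiding : ∀ j w z → within H′ j w a ≡ false → within H′ j w z ≡ true → within H j w z ≡ true
    within-avoiding zero    w z _   wz = wz
    within-avoiding (suc j) w z far wz = last-step (within-sucˡ⁻ H′ j w z wz)
      where
      far′ : within H′ j w a ≡ false
      far′ = true⇒true-contra (within-suc H′ j w a) far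
      last-step : within H′ j w z ≡ true ⊎ ∃ (λ x → within H′ j w x ≡ true × adj H′ x z ≡ true) →
                  within H (suc j) w z ≡ true
      last-step (inj₁ wz′) = within-suc H j w z (within-avoiding j w z far′ wz′)
      last-step (inj₂ (x , wx , xz)) with only x z xz
      ... | inj₁ xz′               = within-adj H j w x z (within-avoiding j w x far′ wx) xz′
      ... | inj₂ (inj₁ (refl , _)) = ⊥-elim (true≢false wx far′)
      ... | inj₂ (inj₂ (_ , refl)) = ⊥-elim (true≢false wz far)

    SameDisc-avoiding : ∀ k w → within H′ k w a ≡ false → SameDisc k H H′ w
    SameDisc-avoiding k w far = record
      { same-ball = λ z → true⇔true⇒≡ (within-mono-⊆ ⊆H′ k w z) (within-avoiding k w z far)
      ; same-adj  = same-adj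
      }
      where
      same-adj : ∀ z₁ z₂ → within H k w z₁ ≡ true → within H k w z₂ ≡ true → adj H z₁ z₂ ≡ adj H′ z₁ z₂
      same-adj z₁ z₂ wz₁ wz₂ = true⇔true⇒≡ (⊆H′ z₁ z₂) new-edge-inside⇒old
        where
        new-edge-inside⇒old : adj H′ z₁ z₂ ≡ true → adj H z₁ z₂ ≡ true
        new-edge-inside⇒old z₁z₂ with only z₁ z₂ z₁z₂
        ... | inj₁ z₁z₂′ = z₁z₂′
        ... | inj₂ (inj₁ (refl , _)) = ⊥-elim (true≢false (within-mono-⊆ ⊆H′ k w a wz₁) far)
        ... | inj₂ (inj₂ (_ , refl)) = ⊥-elim (true≢false (within-mono-⊆ ⊆H′ k w a wz₂) far)

    within-added⁻ : ∀ j w z → within H′ j w z ≡ true →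
                    within H j w z ≡ true ⊎ within H j w a ≡ true ⊎ within H j w b ≡ true
    within-added⁻ zero    w z wz = inj₁ wz
    within-added⁻ (suc j) w z wz with within-sucˡ⁻ H′ j w z wz
    ... | inj₁ wz′ = ⊎.map (within-suc H j w z) (⊎.map (within-suc H j w a) (within-suc H j w b))
                                  (within-added⁻ j w z wz′)
    ... | inj₂ (x , wx , xz) with within-added⁻ j w x wx | only x z xz
    ...   | inj₁ wx′ | inj₁ xz′               = inj₁ (within-adj H j w x z wx′ xz′)
    ...   | inj₁ wx′ | inj₂ (inj₁ (refl , _)) = inj₂ (inj₁ (within-suc H j w x wx′))
    ...   | inj₁ wx′ | inj₂ (inj₂ (refl , _)) = inj₂ (inj₂ (within-suc H j w x wx′))
    ...   | inj₂ wab | _ = inj₂ (⊎.map (within-suc H j w a) (within-suc H j w b) wab)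

    ends-≢ : a ≢ b
    ends-≢ refl = true≢false added (irrefl H′ a)

    deg-added : deg H′ a ≡ suc (deg H a)
    deg-added = begin
      deg H′ a                                                ≡⟨ countV≡sum (adj H′ a) ⟩
      sum (λ y → 𝟙 (adj H′ a y))                              ≡⟨ sum-cong-≗ pointwise ⟩
      sum (λ y → 𝟙 ⌊ y Fin.≟ b ⌋ + 𝟙 (adj H a y))             ≡⟨ ∑-distrib-+ (λ y → 𝟙 ⌊ y Fin.≟ b ⌋) (λ y → 𝟙 (adj H a y)) ⟩
      sum (λ y → 𝟙 ⌊ y Fin.≟ b ⌋) + sum (λ y → 𝟙 (adj H a y)) ≡⟨ cong₂ _+_ (sum-𝟙-≟ b) (sym (countV≡sum (adj H a))) ⟩
      suc (deg H a)                                           ∎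
      where
      open ≡-Reasoning
      pointwise : ∀ y → 𝟙 (adj H′ a y) ≡ 𝟙 ⌊ y Fin.≟ b ⌋ + 𝟙 (adj H a y)
      pointwise y with y Fin.≟ b
      ... | yes refl = trans (cong 𝟙 added) (sym (cong (suc ∘ 𝟙) fresh))
      ... | no y≢b   = cong 𝟙 (true⇔true⇒≡ new⇒old (⊆H′ a y))
        where
        new⇒old : adj H′ a y ≡ true → adj H a y ≡ true
        new⇒old ay with only a y ay
        ... | inj₁ ay′ = ay′
        ... | inj₂ (inj₁ (_ , y≡b)) = ⊥-elim (y≢b y≡b)
        ... | inj₂ (inj₂ (a≡b , _)) = ⊥-elim (ends-≢ a≡b)

    changed⇒near : ∀ k w → discChanged k H H′ w ≡ true → within H k w a ≡ true ⊎ within H k w b ≡ true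
    changed⇒near k w changed with within H′ k w a in near-a
    ... | false = ⊥-elim (true≢false changed (cong not (SameDisc⇒discIso (SameDisc-avoiding k w near-a))))
    ... | true with within-added⁻ k w a near-a
    ...   | inj₁ near-a′ = inj₁ near-a′
    ...   | inj₂ near    = near

  discChanges-AddsEdge-≤ : ∀ {H H′ : Graph n} {a b d} → AddsEdge H H′ a b → Bounded d H′ →
                           ∀ k → discChanges k H H′ ≤ 2 * d ^ k
  discChanges-AddsEdge-≤ {H = H} {H′} {a} {b} {zero} A bounded k =
    ⊥-elim (ℕP.≤⇒≯ (subst (_≤ 0) (deg-added A) (bounded a)) (s≤s z≤n))
  discChanges-AddsEdge-≤ {H = H} {H′} {a} {b} {suc e} A bounded k = begin
    discChanges k H H′                              ≤⟨ sum-mono-≤ pointwise ⟩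
    sum (λ w → 𝟙 (within H k w a) + 𝟙 (within H k w b))
                                                    ≡⟨ ∑-distrib-+ (λ w → 𝟙 (within H k w a)) (λ w → 𝟙 (within H k w b)) ⟩
    ballSize H k a + ballSize H k b                 ≤⟨ ℕP.+-mono-≤ (ball≤ A) (ball≤ (AddsEdge-swap A)) ⟩
    suc e ^ k + suc e ^ k                           ≡⟨ cong (suc e ^ k +_) (ℕP.+-identityʳ (suc e ^ k)) ⟨
    2 * suc e ^ k                                   ∎
    where
    open ℕP.≤-Reasoning
    bounded-H : Bounded (suc e) H
    bounded-H y = ℕP.≤-trans (deg-mono-⊆ H′ {H} (AddsEdge.⊆H′ A) y) (bounded y)
    ball≤ : ∀ {x y} → AddsEdge H H′ x y → ballSize H k x ≤ suc e ^ k
    ball≤ {x} A′ = ballSize-≤-^ H bounded-H (ℕ.s≤s⁻¹ (subst (_≤ suc e) (deg-added A′) (bounded x))) k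
    pointwise : ∀ w → 𝟙 (discChanged k H H′ w) ≤ 𝟙 (within H k w a) + 𝟙 (within H k w b)
    pointwise w with discChanged k H H′ w in changed
    ... | false = z≤n
    ... | true with changed⇒near A k w changed
    ...   | inj₁ near-a = ℕP.≤-trans (1≤𝟙 near-a) (ℕP.m≤m+n _ _)
    ...   | inj₂ near-b = ℕP.≤-trans (1≤𝟙 near-b) (ℕP.m≤n+m _ _)

  -- Edit distance

  differs : Graph n → Graph n → Fin n → Fin n → Bool
  differs G H u v = ⌊ u Fin.<? v ⌋ ∧ (adj G u v xor adj H u v)

  editDist≡sum : (G H : Graph n) → editDist G H ≡ sum (λ u → sum (λ v → 𝟙 (differs G H u v)))
  editDist≡sum {n} G H = trans (foldr-+-map-tabulate id (λ u → countV (differs G H u)))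
                               (sum-cong-≗ (λ u → countV≡sum (differs G H u)))

  editDist≡0⇒adj-≡-< : (G H : Graph n) → editDist G H ≡ 0 → ∀ {x y} → x Fin.< y → adj G x y ≡ adj H x y
  editDist≡0⇒adj-≡-< G H dist≡0 {x} {y} x<y = xor-false⁻ (∧-false⁻ (<?-true⁺ x<y)
    (𝟙≡0⁻ (sum≡0⇒≡0 _ (sum≡0⇒≡0 _ (trans (sym (editDist≡sum G H)) dist≡0) x) y)))

  editDist≡0⇒adj-≡ : (G H : Graph n) → editDist G H ≡ 0 → ∀ x y → adj G x y ≡ adj H x y
  editDist≡0⇒adj-≡ G H dist≡0 x y with FinP.<-cmp x y
  ... | tri< x<y _ _  = editDist≡0⇒adj-≡-< G H dist≡0 x<y
  ... | tri≈ _ refl _ = trans (irrefl G x) (sym (irrefl H x))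
  ... | tri> _ _ y<x  = trans (adj-sym G x y) (trans (editDist≡0⇒adj-≡-< G H dist≡0 y<x) (adj-sym H y x))

  editDist≡suc⇒differs : (G H : Graph n) → ∀ {m} → editDist G H ≡ suc m →
                         ∃ λ u → ∃ λ v → u Fin.< v × (adj G u v xor adj H u v) ≡ true
  editDist≡suc⇒differs G H dist≡suc with sum>0⇒∃>0 _ (subst (0 <_) (trans (sym dist≡suc) (editDist≡sum G H)) (s≤s z≤n))
  ... | u , ∃v with sum>0⇒∃>0 _ ∃v
  ... | v , uv = u , v , <?-true⁻ (∧-true⁻ˡ (𝟙>0⁻ uv)) , ∧-true⁻ʳ {⌊ u Fin.<? v ⌋} (𝟙>0⁻ uv)

  isEdge : Fin n → Fin n → Fin n → Fin n → Bool
  isEdge a b x y = (⌊ x Fin.≟ a ⌋ ∧ ⌊ y Fin.≟ b ⌋) ∨ (⌊ x Fin.≟ b ⌋ ∧ ⌊ y Fin.≟ a ⌋)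

  isEdge-sym : (a b x y : Fin n) → isEdge a b x y ≡ isEdge a b y x
  isEdge-sym a b x y = trans (cong₂ _∨_ (BoolP.∧-comm ⌊ x Fin.≟ a ⌋ _) (BoolP.∧-comm ⌊ x Fin.≟ b ⌋ _))
                             (BoolP.∨-comm (⌊ y Fin.≟ b ⌋ ∧ ⌊ x Fin.≟ a ⌋) _)

  isEdge⁻ : {a b x y : Fin n} → isEdge a b x y ≡ true → (x ≡ a × y ≡ b) ⊎ (x ≡ b × y ≡ a)
  isEdge⁻ {a = a} {b} {x} {y} h with ∨-true⁻ {⌊ x Fin.≟ a ⌋ ∧ ⌊ y Fin.≟ b ⌋} h
  ... | inj₁ xa∧yb = inj₁ (≟-true⁻ (∧-true⁻ˡ xa∧yb) , ≟-true⁻ (∧-true⁻ʳ {⌊ x Fin.≟ a ⌋} xa∧yb))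
  ... | inj₂ xb∧ya = inj₂ (≟-true⁻ (∧-true⁻ˡ xb∧ya) , ≟-true⁻ (∧-true⁻ʳ {⌊ x Fin.≟ b ⌋} xb∧ya))

  isEdge-false⁺ : {a b x y : Fin n} → ¬ ((x ≡ a × y ≡ b) ⊎ (x ≡ b × y ≡ a)) → isEdge a b x y ≡ false
  isEdge-false⁺ {a = a} {b} {x} {y} ¬edge = true⇒true-contra (⊥-elim ∘ ¬edge ∘ isEdge⁻) refl

  addEdge : (H : Graph n) (a b : Fin n) → a ≢ b → Graph n
  addEdge H a b a≢b = record
    { adj     = λ x y → adj H x y ∨ isEdge a b x y
    ; adj-sym = λ x y → cong₂ _∨_ (adj-sym H x y) (isEdge-sym a b x y)
    ; irrefl  = λ x → cong₂ _∨_ (irrefl H x) (isEdge-false⁺ {a = a} {b} {x} {x} λ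
        { (inj₁ (refl , refl)) → a≢b refl
        ; (inj₂ (refl , refl)) → a≢b refl })
    }

  AddsEdge-addEdge : ∀ {H : Graph n} {a b} (a≢b : a ≢ b) → adj H a b ≡ false → AddsEdge H (addEdge H a b a≢b) a b
  AddsEdge-addEdge {H = H} {a} {b} a≢b fresh = record
    { ⊆H′   = λ x y xy → ∨-true⁺ˡ xy
    ; added = ∨-true⁺ʳ {a = adj H a b} (∨-true⁺ˡ (∧-true⁺ (≟-true⁺ {x = a} refl) (≟-true⁺ {x = b} refl)))
    ; fresh = fresh
    ; only  = λ x y xy → ⊎.map₂ isEdge⁻ (∨-true⁻ {adj H x y} xy)
    }

  module _ {H K : Graph n} {a b : Fin n} (a<b : a Fin.< b) (fresh : adj H a b ≡ false) (inK : adj K a b ≡ true) where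

    private
      H′ : Graph n
      H′ = addEdge H a b (FinP.<⇒≢ a<b)

      isAB : Fin n → Fin n → Bool
      isAB u v = ⌊ u Fin.≟ a ⌋ ∧ ⌊ v Fin.≟ b ⌋

      isAB-false : ∀ {u v} → ¬ (u ≡ a × v ≡ b) → isAB u v ≡ false
      isAB-false {u} {v} ¬ab = true⇒true-contra (λ ab → ⊥-elim (¬ab (≟-true⁻ (∧-true⁻ˡ ab) ,
                                                                      ≟-true⁻ (∧-true⁻ʳ {⌊ u Fin.≟ a ⌋} ab)))) refl

      differs-addEdge : ∀ {u v} → ¬ (u ≡ a × v ≡ b) → differs H′ K u v ≡ differs H K u v
      differs-addEdge {u} {v} ¬ab with u Fin.<? v
      ... | no _    = refl
      ... | yes u<v = cong (λ t → t xor adj K u v)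
                           (trans (cong (adj H u v ∨_) (isEdge-false⁺ not-edge)) (BoolP.∨-identityʳ (adj H u v)))
        where
        not-edge : ¬ ((u ≡ a × v ≡ b) ⊎ (u ≡ b × v ≡ a))
        not-edge (inj₁ ab)           = ¬ab ab
        not-edge (inj₂ (refl , refl)) = FinP.<-asym a<b u<v

      differs-split : ∀ u v → 𝟙 (differs H K u v) ≡ 𝟙 (differs H′ K u v) + 𝟙 (isAB u v)
      differs-split u v with (u Fin.≟ a) ×-dec (v Fin.≟ b)
      ... | yes (refl , refl)
        rewrite <?-true⁺ a<b | fresh | inK | ≟-true⁺ {x = a} refl | ≟-true⁺ {x = b} refl = refl
      ... | no ¬ab = begin
        𝟙 (differs H K u v)                    ≡⟨ cong 𝟙 (differs-addEdge ¬ab) ⟨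
        𝟙 (differs H′ K u v)                   ≡⟨ ℕP.+-identityʳ _ ⟨
        𝟙 (differs H′ K u v) + 0               ≡⟨ cong (λ t → 𝟙 (differs H′ K u v) + 𝟙 t) (isAB-false ¬ab) ⟨
        𝟙 (differs H′ K u v) + 𝟙 (isAB u v)    ∎
        where open ≡-Reasoning

      sum-isAB : sum (λ u → sum (λ v → 𝟙 (isAB u v))) ≡ 1
      sum-isAB = begin
        sum (λ u → sum (λ v → 𝟙 (isAB u v)))               ≡⟨ sum-cong-≗ (λ u → sum-cong-≗ (λ v → 𝟙-∧ ⌊ u Fin.≟ a ⌋ ⌊ v Fin.≟ b ⌋)) ⟩
        sum (λ u → sum (λ v → 𝟙 ⌊ u Fin.≟ a ⌋ * 𝟙 ⌊ v Fin.≟ b ⌋))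
          ≡⟨ sum-cong-≗ (λ u → sym (*-distribˡ-sum (𝟙 ⌊ u Fin.≟ a ⌋) (λ v → 𝟙 ⌊ v Fin.≟ b ⌋))) ⟩
        sum (λ u → 𝟙 ⌊ u Fin.≟ a ⌋ * sum (λ v → 𝟙 ⌊ v Fin.≟ b ⌋))
          ≡⟨ sum-cong-≗ (λ u → trans (cong (𝟙 ⌊ u Fin.≟ a ⌋ *_) (sum-𝟙-≟ b)) (ℕP.*-identityʳ _)) ⟩
        sum (λ u → 𝟙 ⌊ u Fin.≟ a ⌋)                        ≡⟨ sum-𝟙-≟ a ⟩
        1                                                  ∎
        where open ≡-Reasoning

    editDist-addEdge : editDist H K ≡ suc (editDist H′ K)
    editDist-addEdge = begin
      editDist H K                                                   ≡⟨ editDist≡sum H K ⟩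
      sum (λ u → sum (λ v → 𝟙 (differs H K u v)))                    ≡⟨ sum-cong-≗ (λ u → sum-cong-≗ (differs-split u)) ⟩
      sum (λ u → sum (λ v → 𝟙 (differs H′ K u v) + 𝟙 (isAB u v)))    ≡⟨ sum-cong-≗ (λ u →
                                                                          ∑-distrib-+ (λ v → 𝟙 (differs H′ K u v)) (λ v → 𝟙 (isAB u v))) ⟩
      sum (λ u → sum (λ v → 𝟙 (differs H′ K u v)) + sum (λ v → 𝟙 (isAB u v)))
                                                                     ≡⟨ ∑-distrib-+ (λ u → sum (λ v → 𝟙 (differs H′ K u v))) (λ u → sum (λ v → 𝟙 (isAB u v))) ⟩
      sum (λ u → sum (λ v → 𝟙 (differs H′ K u v))) + sum (λ u → sum (λ v → 𝟙 (isAB u v)))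
                                                                     ≡⟨ cong₂ _+_ (sym (editDist≡sum H′ K)) sum-isAB ⟩
      editDist H′ K + 1                                              ≡⟨ ℕP.+-comm _ 1 ⟩
      suc (editDist H′ K)                                            ∎
      where open ≡-Reasoning

  -- Discs changed by an edit

  module _ (k : ℕ) where

    discChanges-triangle : (H₁ H₂ H₃ : Graph n) →
                           discChanges k H₁ H₃ ≤ discChanges k H₁ H₂ + discChanges k H₂ H₃
    discChanges-triangle H₁ H₂ H₃ = ℕP.≤-trans (sum-mono-≤ pointwise)
      (ℕP.≤-reflexive (∑-distrib-+ (𝟙 ∘ discChanged k H₁ H₂) (𝟙 ∘ discChanged k H₂ H₃)))
      where
      pointwise : ∀ w → 𝟙 (not (discIso k H₁ w H₃ w)) ≤ 𝟙 (not (discIso k H₁ w H₂ w)) + 𝟙 (not (discIso k H₂ w H₃ w))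
      pointwise w with discIso k H₁ w H₂ w in ≅₁₂ | discIso k H₂ w H₃ w in ≅₂₃
      ... | false | _    = ℕP.≤-trans (𝟙≤1 (not (discIso k H₁ w H₃ w))) (s≤s z≤n)
      ... | true  | false = 𝟙≤1 (not (discIso k H₁ w H₃ w))
      ... | true  | true  = ℕP.≤-reflexive (cong (𝟙 ∘ not) (discIso-trans k H₁ w H₂ w H₃ w ≅₁₂ ≅₂₃))

    discChanges-sym : (H K : Graph n) → discChanges k H K ≡ discChanges k K H
    discChanges-sym H K = sum-cong-≗ λ w → cong (𝟙 ∘ not)
      (true⇔true⇒≡ (discIso-sym k H w K w) (discIso-sym k K w H w))

    discChanges-adj-≡ : (H K : Graph n) → (∀ x y → adj H x y ≡ adj K x y) → discChanges k H K ≡ 0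
    discChanges-adj-≡ H K adj-≡ = sum-zero λ w → cong (𝟙 ∘ not) (SameDisc⇒discIso {k = k} {H} {K} {w} record
      { same-ball = λ z → true⇔true⇒≡ (within-mono-⊆ H⊆K k w z) (within-mono-⊆ K⊆H k w z)
      ; same-adj  = λ z₁ z₂ _ _ → adj-≡ z₁ z₂
      })
      where
      H⊆K : H ⊆ᴳ K
      H⊆K x y = trans (sym (adj-≡ x y))
      K⊆H : K ⊆ᴳ H
      K⊆H x y = trans (adj-≡ x y)

    discChanges-⊆-≤ : ∀ {d} {K : Graph n} → Bounded d K →
                      ∀ m {H} → H ⊆ᴳ K → editDist H K ≡ m → discChanges k H K ≤ m * (2 * d ^ k)
    discChanges-⊆-≤ {K = K} bounded zero {H} H⊆K dist≡0 =
      ℕP.≤-reflexive (discChanges-adj-≡ H K (editDist≡0⇒adj-≡ H K dist≡0))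
    discChanges-⊆-≤ {n} {d} {K} bounded (suc m) {H} H⊆K dist≡suc
      with a , b , a<b , ab-differs ← editDist≡suc⇒differs H K dist≡suc = begin
        discChanges k H K                      ≤⟨ discChanges-triangle H H′ K ⟩
        discChanges k H H′ + discChanges k H′ K ≤⟨ ℕP.+-mono-≤ (discChanges-AddsEdge-≤ A bounded-H′ k)
                                                              (discChanges-⊆-≤ bounded m H′⊆K dist′≡m) ⟩
        2 * d ^ k + m * (2 * d ^ k)            ∎
      where
      open ℕP.≤-Reasoning
      fresh : adj H a b ≡ false
      fresh = proj₁ (xor-true-⊆ (H⊆K a b) ab-differs)
      inK : adj K a b ≡ true
      inK = proj₂ (xor-true-⊆ (H⊆K a b) ab-differs)
      a≢b : a ≢ b
      a≢b = FinP.<⇒≢ a<b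
      H′ : Graph n
      H′ = addEdge H a b a≢b
      A : AddsEdge H H′ a b
      A = AddsEdge-addEdge a≢b fresh
      H′⊆K : H′ ⊆ᴳ K
      H′⊆K x y xy with AddsEdge.only A x y xy
      ... | inj₁ xy′                = H⊆K x y xy′
      ... | inj₂ (inj₁ (refl , refl)) = inK
      ... | inj₂ (inj₂ (refl , refl)) = trans (adj-sym K b a) inK
      bounded-H′ : Bounded d H′
      bounded-H′ y = ℕP.≤-trans (deg-mono-⊆ K {H′} H′⊆K y) (bounded y)
      dist′≡m : editDist H′ K ≡ m
      dist′≡m = ℕP.suc-injective (trans (sym (editDist-addEdge {H = H} {K} a<b fresh inK)) dist≡suc)

  _∩_ : Graph n → Graph n → Graph n
  G₁ ∩ G₂ = record
    { adj     = λ x y → adj G₁ x y ∧ adj G₂ x y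
    ; adj-sym = λ x y → cong₂ _∧_ (adj-sym G₁ x y) (adj-sym G₂ x y)
    ; irrefl  = λ x → cong (_∧ adj G₂ x x) (irrefl G₁ x)
    }

  editDist-∩ : (G₁ G₂ : Graph n) → editDist G₁ G₂ ≡ editDist (G₁ ∩ G₂) G₁ + editDist (G₁ ∩ G₂) G₂
  editDist-∩ {n} G₁ G₂ = begin
    editDist G₁ G₂                                          ≡⟨ editDist≡sum G₁ G₂ ⟩
    sum (λ u → sum (λ v → 𝟙 (differs G₁ G₂ u v)))          ≡⟨ sum-cong-≗ (λ u → trans
                                                                (sum-cong-≗ (λ v → split ⌊ u Fin.<? v ⌋ (adj G₁ u v) (adj G₂ u v)))
                                                                (∑-distrib-+ (λ v → 𝟙 (differs M G₁ u v)) (λ v → 𝟙 (differs M G₂ u v)))) ⟩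
    sum (λ u → sum (λ v → 𝟙 (differs M G₁ u v)) + sum (λ v → 𝟙 (differs M G₂ u v)))
                                                            ≡⟨ ∑-distrib-+ (λ u → sum (λ v → 𝟙 (differs M G₁ u v)))
                                                                            (λ u → sum (λ v → 𝟙 (differs M G₂ u v))) ⟩
    sum (λ u → sum (λ v → 𝟙 (differs M G₁ u v))) + sum (λ u → sum (λ v → 𝟙 (differs M G₂ u v)))
                                                            ≡⟨ cong₂ _+_ (editDist≡sum M G₁) (editDist≡sum M G₂) ⟨
    editDist M G₁ + editDist M G₂                           ∎
    where
    open ≡-Reasoning
    M : Graph n
    M = G₁ ∩ G₂
    split : ∀ c g₁ g₂ → 𝟙 (c ∧ (g₁ xor g₂)) ≡ 𝟙 (c ∧ ((g₁ ∧ g₂) xor g₁)) + 𝟙 (c ∧ ((g₁ ∧ g₂) xor g₂))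
    split false _     _     = refl
    split true  true  true  = refl
    split true  true  false = refl
    split true  false true  = refl
    split true  false false = refl

  discChanges-≤ : ∀ k {d} {G₁ G₂ : Graph n} → Bounded d G₁ → Bounded d G₂ →
                  discChanges k G₁ G₂ ≤ editDist G₁ G₂ * (2 * d ^ k)
  discChanges-≤ {n} k {d} {G₁} {G₂} bounded₁ bounded₂ = begin
    discChanges k G₁ G₂                                     ≤⟨ discChanges-triangle k G₁ M G₂ ⟩
    discChanges k G₁ M + discChanges k M G₂                 ≡⟨ cong (_+ discChanges k M G₂) (discChanges-sym k G₁ M) ⟩
    discChanges k M G₁ + discChanges k M G₂                 ≤⟨ ℕP.+-mono-≤
                                                                 (discChanges-⊆-≤ k bounded₁ _ (λ x y → ∧-true⁻ˡ) refl)
                                                                 (discChanges-⊆-≤ k bounded₂ _ (λ x y → ∧-true⁻ʳ {adj G₁ x y}) refl) ⟩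
    editDist M G₁ * (2 * d ^ k) + editDist M G₂ * (2 * d ^ k) ≡⟨ ℕP.*-distribʳ-+ (2 * d ^ k) (editDist M G₁) _ ⟨
    (editDist M G₁ + editDist M G₂) * (2 * d ^ k)           ≡⟨ cong (_* (2 * d ^ k)) (editDist-∩ G₁ G₂) ⟨
    editDist G₁ G₂ * (2 * d ^ k)                            ∎
    where
    open ℕP.≤-Reasoning
    M : Graph n
    M = G₁ ∩ G₂

module RationalArithmetic where
  open import Data.Fin using (Fin; zero; suc)
  open import Data.List using (map; foldr; tabulate)
  open import Data.Nat as ℕ using (ℕ; zero; suc; _∸_; ∣_-_∣)
  import Data.Nat.Properties as ℕP
  open import Data.Integer as ℤ using (+_)
  import Data.Integer.Properties as ℤP
  open import Data.Rational as ℚ using (ℚ; 0ℚ; 1ℚ; ∣_∣; fromℚᵘ)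
  import Data.Rational.Properties as ℚP
  open import Data.Rational.Unnormalised as ℚᵘ using (ℚᵘ; mkℚᵘ; *≡*)
  import Data.Rational.Unnormalised.Properties as ℚᵘP
  open import Data.Rational.Solver using (module +-*-Solver)
  open import Data.Integer.Solver renaming (module +-*-Solver to ℤSolver)
  open import Data.Sum using (inj₁; inj₂)
  open import Function using (_∘_)
  open import Relation.Binary.PropositionalEquality
  open import Algebra.Properties.Semiring.Sum ℕP.+-*-semiring using (sum)

  fromℚᵘ-homo-+ : ∀ p q → fromℚᵘ (p ℚᵘ.+ q) ≡ fromℚᵘ p ℚ.+ fromℚᵘ q
  fromℚᵘ-homo-+ p q = ℚP.toℚᵘ-injective (ℚᵘP.≃-trans (ℚP.toℚᵘ-fromℚᵘ (p ℚᵘ.+ q)) (ℚᵘP.≃-sym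
    (ℚᵘP.≃-trans (ℚP.toℚᵘ-homo-+ (fromℚᵘ p) (fromℚᵘ q)) (ℚᵘP.+-cong (ℚP.toℚᵘ-fromℚᵘ p) (ℚP.toℚᵘ-fromℚᵘ q)))))

  fromℚᵘ-homo-* : ∀ p q → fromℚᵘ (p ℚᵘ.* q) ≡ fromℚᵘ p ℚ.* fromℚᵘ q
  fromℚᵘ-homo-* p q = ℚP.toℚᵘ-injective (ℚᵘP.≃-trans (ℚP.toℚᵘ-fromℚᵘ (p ℚᵘ.* q)) (ℚᵘP.≃-sym
    (ℚᵘP.≃-trans (ℚP.toℚᵘ-homo-* (fromℚᵘ p) (fromℚᵘ q)) (ℚᵘP.*-cong (ℚP.toℚᵘ-fromℚᵘ p) (ℚP.toℚᵘ-fromℚᵘ q)))))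

  ℕtoℚ-+ : ∀ a b → ℕtoℚ (a ℕ.+ b) ≡ ℕtoℚ a ℚ.+ ℕtoℚ b
  ℕtoℚ-+ a b = trans (ℚP.fromℚᵘ-cong sum≃) (fromℚᵘ-homo-+ (mkℚᵘ (+ a) 0) (mkℚᵘ (+ b) 0))
    where
    open ℤSolver
    sum≃ : mkℚᵘ (+ (a ℕ.+ b)) 0 ℚᵘ.≃ (mkℚᵘ (+ a) 0 ℚᵘ.+ mkℚᵘ (+ b) 0)
    sum≃ = *≡* (trans (cong (ℤ._* + 1) (ℤP.pos-+ a b))
      (solve 2 (λ x y → (x :+ y) :* con (+ 1) := (x :* con (+ 1) :+ y :* con (+ 1)) :* con (+ 1)) refl (+ a) (+ b)))

  ℕtoℚ-* : ∀ a b → ℕtoℚ (a ℕ.* b) ≡ ℕtoℚ a ℚ.* ℕtoℚ b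
  ℕtoℚ-* a b = trans (ℚP.fromℚᵘ-cong product≃) (fromℚᵘ-homo-* (mkℚᵘ (+ a) 0) (mkℚᵘ (+ b) 0))
    where
    product≃ : mkℚᵘ (+ (a ℕ.* b)) 0 ℚᵘ.≃ (mkℚᵘ (+ a) 0 ℚᵘ.* mkℚᵘ (+ b) 0)
    product≃ = *≡* (cong (ℤ._* + 1) (ℤP.pos-* a b))

  0≤ℕtoℚ : ∀ a → 0ℚ ℚ.≤ ℕtoℚ a
  0≤ℕtoℚ a = ℚP.nonNegative⁻¹ (ℕtoℚ a) {{ℚP.normalize-nonNeg a 1}}

  ℕtoℚ-mono-≤ : ∀ {a b} → a ℕ.≤ b → ℕtoℚ a ℚ.≤ ℕtoℚ b
  ℕtoℚ-mono-≤ {a} {b} a≤b = begin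
    ℕtoℚ a                     ≡⟨ ℚP.+-identityʳ (ℕtoℚ a) ⟨
    ℕtoℚ a ℚ.+ 0ℚ              ≤⟨ ℚP.+-monoʳ-≤ (ℕtoℚ a) (0≤ℕtoℚ (b ∸ a)) ⟩
    ℕtoℚ a ℚ.+ ℕtoℚ (b ∸ a)    ≡⟨ ℕtoℚ-+ a (b ∸ a) ⟨
    ℕtoℚ (a ℕ.+ (b ∸ a))       ≡⟨ cong ℕtoℚ (ℕP.m+[n∸m]≡n a≤b) ⟩
    ℕtoℚ b                     ∎
    where open ℚP.≤-Reasoning

  1/ : (n : ℕ) .{{_ : ℕ.NonZero n}} → ℚ
  1/ n = + 1 ℚ./ n

  1/-nonNeg : ∀ m → ℚ.NonNegative (1/ (suc m))
  1/-nonNeg m = ℚP.normalize-nonNeg 1 (suc m)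

  /≡*1/ : ∀ a m → + a ℚ./ suc m ≡ ℕtoℚ a ℚ.* 1/ (suc m)
  /≡*1/ a m = trans (ℚP.fromℚᵘ-cong a/m≃) (fromℚᵘ-homo-* (mkℚᵘ (+ a) 0) (mkℚᵘ (+ 1) m))
    where
    open ℤSolver
    a/m≃ : mkℚᵘ (+ a) m ℚᵘ.≃ (mkℚᵘ (+ a) 0 ℚᵘ.* mkℚᵘ (+ 1) m)
    a/m≃ = *≡* (trans (cong (λ t → + a ℤ.* + suc t) (ℕP.+-identityʳ m))
      (solve 2 (λ x y → x :* y := (x :* con (+ 1)) :* y) refl (+ a) (+ suc m)))

  n*1/n≡1 : ∀ m → ℕtoℚ (suc m) ℚ.* 1/ (suc m) ≡ 1ℚ
  n*1/n≡1 m = trans (sym (fromℚᵘ-homo-* (mkℚᵘ (+ suc m) 0) (mkℚᵘ (+ 1) m))) (ℚP.fromℚᵘ-cong n/n≃1)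
    where
    open ℤSolver
    n/n≃1 : (mkℚᵘ (+ suc m) 0 ℚᵘ.* mkℚᵘ (+ 1) m) ℚᵘ.≃ mkℚᵘ (+ 1) 0
    n/n≃1 = *≡* (trans (solve 1 (λ y → (y :* con (+ 1)) :* con (+ 1) := con (+ 1) :* y) refl (+ suc m))
                       (cong (λ t → + 1 ℤ.* + suc t) (sym (ℕP.+-identityʳ m))))

  ∣ℕtoℚ-ℕtoℚ∣ : ∀ a b → ∣ ℕtoℚ a ℚ.- ℕtoℚ b ∣ ≡ ℕtoℚ ∣ a - b ∣
  ∣ℕtoℚ-ℕtoℚ∣ a b with ℕP.≤-total a b
  ... | inj₁ a≤b = begin
    ∣ ℕtoℚ a ℚ.- ℕtoℚ b ∣                     ≡⟨ cong (λ t → ∣ ℕtoℚ a ℚ.- t ∣)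
                                                  (trans (cong ℕtoℚ (sym (ℕP.m+[n∸m]≡n a≤b))) (ℕtoℚ-+ a (b ∸ a))) ⟩
    ∣ ℕtoℚ a ℚ.- (ℕtoℚ a ℚ.+ ℕtoℚ (b ∸ a)) ∣  ≡⟨ cong ∣_∣ (solve 2 (λ x c → x :- (x :+ c) := :- c) refl (ℕtoℚ a) _) ⟩
    ∣ ℚ.- ℕtoℚ (b ∸ a) ∣                      ≡⟨ ℚP.∣-p∣≡∣p∣ (ℕtoℚ (b ∸ a)) ⟩
    ∣ ℕtoℚ (b ∸ a) ∣                          ≡⟨ ℚP.0≤p⇒∣p∣≡p (0≤ℕtoℚ (b ∸ a)) ⟩
    ℕtoℚ (b ∸ a)                              ≡⟨ cong ℕtoℚ (ℕP.m≤n⇒∣m-n∣≡n∸m a≤b) ⟨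
    ℕtoℚ ∣ a - b ∣                            ∎
    where
    open ≡-Reasoning
    open +-*-Solver
  ... | inj₂ b≤a = begin
    ∣ ℕtoℚ a ℚ.- ℕtoℚ b ∣                     ≡⟨ cong (λ t → ∣ t ℚ.- ℕtoℚ b ∣)
                                                  (trans (cong ℕtoℚ (sym (ℕP.m+[n∸m]≡n b≤a))) (ℕtoℚ-+ b (a ∸ b))) ⟩
    ∣ (ℕtoℚ b ℚ.+ ℕtoℚ (a ∸ b)) ℚ.- ℕtoℚ b ∣  ≡⟨ cong ∣_∣ (solve 2 (λ x c → (x :+ c) :- x := c) refl (ℕtoℚ b) _) ⟩
    ∣ ℕtoℚ (a ∸ b) ∣                          ≡⟨ ℚP.0≤p⇒∣p∣≡p (0≤ℕtoℚ (a ∸ b)) ⟩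
    ℕtoℚ (a ∸ b)                              ≡⟨ cong ℕtoℚ (ℕP.m≤n⇒∣n-m∣≡n∸m b≤a) ⟨
    ℕtoℚ ∣ a - b ∣                            ∎
    where
    open ≡-Reasoning
    open +-*-Solver

  ∣/-/∣ : ∀ a b m → ∣ (+ a ℚ./ suc m) ℚ.- (+ b ℚ./ suc m) ∣ ≡ ℕtoℚ ∣ a - b ∣ ℚ.* 1/ (suc m)
  ∣/-/∣ a b m = begin
    ∣ (+ a ℚ./ suc m) ℚ.- (+ b ℚ./ suc m) ∣         ≡⟨ cong₂ (λ s t → ∣ s ℚ.- t ∣) (/≡*1/ a m) (/≡*1/ b m) ⟩
    ∣ ℕtoℚ a ℚ.* r ℚ.- ℕtoℚ b ℚ.* r ∣               ≡⟨ cong ∣_∣ (solve 3 (λ x y z → x :* z :- y :* z := (x :- y) :* z)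
                                                         refl (ℕtoℚ a) (ℕtoℚ b) r) ⟩
    ∣ (ℕtoℚ a ℚ.- ℕtoℚ b) ℚ.* r ∣                   ≡⟨ ℚP.∣p*q∣≡∣p∣*∣q∣ (ℕtoℚ a ℚ.- ℕtoℚ b) r ⟩
    ∣ ℕtoℚ a ℚ.- ℕtoℚ b ∣ ℚ.* ∣ r ∣                 ≡⟨ cong₂ ℚ._*_ (∣ℕtoℚ-ℕtoℚ∣ a b) (ℚP.0≤p⇒∣p∣≡p 0≤r) ⟩
    ℕtoℚ ∣ a - b ∣ ℚ.* r                            ∎
    where
    open ≡-Reasoning
    open +-*-Solver
    r : ℚ
    r = 1/ (suc m)
    0≤r : 0ℚ ℚ.≤ r
    0≤r = ℚP.nonNegative⁻¹ r {{1/-nonNeg m}}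

  ≤q*n⇒*c/n≤q*c : ∀ {e} q m c → ℕtoℚ e ℚ.≤ q ℚ.* ℕtoℚ (suc m) → ℕtoℚ (e ℕ.* c) ℚ.* 1/ (suc m) ℚ.≤ q ℚ.* ℕtoℚ c
  ≤q*n⇒*c/n≤q*c {e} q m c e≤qn = begin
    ℕtoℚ (e ℕ.* c) ℚ.* r                   ≡⟨ cong (ℚ._* r) (ℕtoℚ-* e c) ⟩
    (ℕtoℚ e ℚ.* ℕtoℚ c) ℚ.* r              ≡⟨ ℚP.*-assoc (ℕtoℚ e) (ℕtoℚ c) r ⟩
    ℕtoℚ e ℚ.* (ℕtoℚ c ℚ.* r)              ≤⟨ ℚP.*-monoʳ-≤-nonNeg (ℕtoℚ c ℚ.* r) {{c*r-nonNeg}} e≤qn ⟩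
    (q ℚ.* ℕtoℚ (suc m)) ℚ.* (ℕtoℚ c ℚ.* r) ≡⟨ solve 4 (λ x n y z → (x :* n) :* (y :* z) := (x :* y) :* (n :* z))
                                                  refl q (ℕtoℚ (suc m)) (ℕtoℚ c) r ⟩
    (q ℚ.* ℕtoℚ c) ℚ.* (ℕtoℚ (suc m) ℚ.* r) ≡⟨ cong ((q ℚ.* ℕtoℚ c) ℚ.*_) (n*1/n≡1 m) ⟩
    (q ℚ.* ℕtoℚ c) ℚ.* 1ℚ                  ≡⟨ ℚP.*-identityʳ (q ℚ.* ℕtoℚ c) ⟩
    q ℚ.* ℕtoℚ c                           ∎
    where
    open ℚP.≤-Reasoning
    open +-*-Solver
    r : ℚ
    r = 1/ (suc m)
    c*r-nonNeg : ℚ.NonNegative (ℕtoℚ c ℚ.* r)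
    c*r-nonNeg = ℚP.nonNeg*nonNeg⇒nonNeg (ℕtoℚ c) {{ℚP.normalize-nonNeg c 1}} r {{1/-nonNeg m}}

  foldr-+-map-tabulate-≤ : ∀ {n} {A : Set} (g : Fin n → A) (f : A → ℚ) (h : Fin n → ℕ) (q : ℚ) →
                           (∀ i → f (g i) ℚ.≤ ℕtoℚ (h i) ℚ.* q) → foldr ℚ._+_ 0ℚ (map f (tabulate g)) ℚ.≤ ℕtoℚ (sum h) ℚ.* q
  foldr-+-map-tabulate-≤ {zero}  g f h q f≤hq = ℚP.≤-reflexive (sym (ℚP.*-zeroˡ q))
  foldr-+-map-tabulate-≤ {suc n} g f h q f≤hq = begin
    f (g zero) ℚ.+ foldr ℚ._+_ 0ℚ (map f (tabulate (g ∘ suc)))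
      ≤⟨ ℚP.+-mono-≤ (f≤hq zero) (foldr-+-map-tabulate-≤ (g ∘ suc) f (h ∘ suc) q (f≤hq ∘ suc)) ⟩
    ℕtoℚ (h zero) ℚ.* q ℚ.+ ℕtoℚ (sum (h ∘ suc)) ℚ.* q
      ≡⟨ ℚP.*-distribʳ-+ q (ℕtoℚ (h zero)) (ℕtoℚ (sum (h ∘ suc))) ⟨
    (ℕtoℚ (h zero) ℚ.+ ℕtoℚ (sum (h ∘ suc))) ℚ.* q
      ≡⟨ cong (ℚ._* q) (ℕtoℚ-+ (h zero) (sum (h ∘ suc))) ⟨
    ℕtoℚ (sum h) ℚ.* q ∎
    where open ℚP.≤-Reasoning

open import Data.Bool using (true; false; if_then_else_)
open import Data.List using (allFin; foldr; map)
import Data.Nat as ℕ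
open import Data.Nat using (ℕ; NonZero; suc; _≤_; _^_; _+_)
import Data.Nat.Properties as ℕP
open import Data.Nat.Solver renaming (module +-*-Solver to ℕSolver)
import Data.Rational as ℚ
open import Data.Rational using (ℚ; _<_; _*_; 0ℚ)
import Data.Rational.Properties as ℚP
open import Data.Rational.Solver renaming (module +-*-Solver to ℚSolver)
open import Data.Unit using (tt)
open import Function using (id)
open import Relation.Nullary.Decidable using (toWitness)
open Discs
open RationalArithmetic
open import Relation.Binary.PropositionalEquality

if-≤ : ∀ b {p : ℚ} {v q} → p ≡ ℕtoℚ v * q → (if b then p else 0ℚ) ℚ.≤ ℕtoℚ (𝟙 b ℕ.* v) * q
if-≤ true  {v = v} {q} p≡vq = ℚP.≤-reflexive (trans p≡vq (cong (λ t → ℕtoℚ t * q) (sym (ℕP.+-identityʳ v))))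
if-≤ false {q = q} _        = ℚP.≤-reflexive (sym (ℚP.*-zeroˡ q))

module _ (k m : ℕ) (G₁ G₂ : Graph (suc m)) where
  open Discrepancy k G₁ G₂

  freqAt-distance : ∀ H x → ℚ.∣ freqAt k G₁ H x ℚ.- freqAt k G₂ H x ∣ ≡
                            ℕtoℚ ℕ.∣ typeCount k G₁ H x - typeCount k G₂ H x ∣ * 1/ (suc m)
  freqAt-distance H x = trans (∣/-/∣ (discCount k G₁ H x) (discCount k G₂ H x) m)
    (cong₂ (λ a b → ℕtoℚ ℕ.∣ a - b ∣ * 1/ (suc m))
           (countV≡sum (λ v → discIso k G₁ v H x)) (countV≡sum (λ v → discIso k G₂ v H x)))

  l1FreqDist-≤ : l1FreqDist k G₁ G₂ ℚ.≤ ℕtoℚ (typeDiscrepancy G₁ isRep₁ + typeDiscrepancy G₂ isRep₂) * 1/ (suc m)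
  l1FreqDist-≤ = begin
    l1FreqDist k G₁ G₂                      ≤⟨ ℚP.+-mono-≤ (part G₁ isRep₁) (part G₂ isRep₂) ⟩
    ℕtoℚ t₁ * r ℚ.+ ℕtoℚ t₂ * r             ≡⟨ ℚP.*-distribʳ-+ r (ℕtoℚ t₁) (ℕtoℚ t₂) ⟨
    (ℕtoℚ t₁ ℚ.+ ℕtoℚ t₂) * r               ≡⟨ cong (_* r) (ℕtoℚ-+ t₁ t₂) ⟨
    ℕtoℚ (t₁ + t₂) * r                      ∎
    where
    open ℚP.≤-Reasoning
    r : ℚ
    r = 1/ (suc m)
    t₁ t₂ : ℕ
    t₁ = typeDiscrepancy G₁ isRep₁
    t₂ = typeDiscrepancy G₂ isRep₂
    part : ∀ H isRep →
           foldr ℚ._+_ 0ℚ (map (λ x → if isRep x then ℚ.∣ freqAt k G₁ H x ℚ.- freqAt k G₂ H x ∣ else 0ℚ) (allFin (suc m)))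
             ℚ.≤ ℕtoℚ (typeDiscrepancy H isRep) * r
    part H isRep = foldr-+-map-tabulate-≤ id
      (λ x → if isRep x then ℚ.∣ freqAt k G₁ H x ℚ.- freqAt k G₂ H x ∣ else 0ℚ)
      (λ x → 𝟙 (isRep x) ℕ.* ℕ.∣ typeCount k G₁ H x - typeCount k G₂ H x ∣) r
      (λ x → if-≤ (isRep x) (freqAt-distance H x))

  typeDiscrepancy-≤-editDist : ∀ {d} → Bounded d G₁ → Bounded d G₂ →
    typeDiscrepancy G₁ isRep₁ + typeDiscrepancy G₂ isRep₂ ≤ editDist G₁ G₂ ℕ.* (4 ℕ.* d ^ k)
  typeDiscrepancy-≤-editDist {d} bounded₁ bounded₂ = begin
    typeDiscrepancy G₁ isRep₁ + typeDiscrepancy G₂ isRep₂ ≤⟨ typeDiscrepancy-≤-changes ⟩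
    2 ℕ.* discChanges k G₁ G₂                            ≤⟨ ℕP.*-monoʳ-≤ 2 (discChanges-≤ k bounded₁ bounded₂) ⟩
    2 ℕ.* (editDist G₁ G₂ ℕ.* (2 ℕ.* d ^ k))             ≡⟨ solve 2 (λ e x → con 2 :* (e :* (con 2 :* x)) := e :* (con 4 :* x))
                                                              refl (editDist G₁ G₂) (d ^ k) ⟩
    editDist G₁ G₂ ℕ.* (4 ℕ.* d ^ k)                     ∎
    where
    open ℕP.≤-Reasoning
    open ℕSolver using (solve; _:*_; _:=_; con)

4εd^[k+1]<6εd^[k+1] : ∀ ε k d → 0ℚ < ε → 1 ≤ d →
                      (ε * ℕtoℚ d) * ℕtoℚ (4 ℕ.* d ^ k) < (ℕtoℚ 6 * ε) * ℕtoℚ (d ^ (k + 1))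
4εd^[k+1]<6εd^[k+1] ε k d 0<ε 1≤d = begin-strict
  (ε * ℕtoℚ d) * ℕtoℚ (4 ℕ.* d ^ k)          ≡⟨ cong ((ε * ℕtoℚ d) *_) (ℕtoℚ-* 4 (d ^ k)) ⟩
  (ε * ℕtoℚ d) * (ℕtoℚ 4 * ℕtoℚ (d ^ k))     ≡⟨ solve 4 (λ e x f y → (e :* x) :* (f :* y) := f :* (e :* (x :* y)))
                                                   refl ε (ℕtoℚ d) (ℕtoℚ 4) (ℕtoℚ (d ^ k)) ⟩
  ℕtoℚ 4 * (ε * (ℕtoℚ d * ℕtoℚ (d ^ k)))     ≡⟨ cong (λ t → ℕtoℚ 4 * (ε * t)) d^[k+1]≡ ⟨
  ℕtoℚ 4 * X                                 <⟨ ℚP.*-monoˡ-<-pos X {{X>0}} (toWitness {a? = ℕtoℚ 4 ℚP.<? ℕtoℚ 6} tt) ⟩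
  ℕtoℚ 6 * X                                 ≡⟨ ℚP.*-assoc (ℕtoℚ 6) ε (ℕtoℚ (d ^ (k + 1))) ⟨
  (ℕtoℚ 6 * ε) * ℕtoℚ (d ^ (k + 1))          ∎
  where
  open ℚP.≤-Reasoning
  open ℚSolver
  X : ℚ
  X = ε * ℕtoℚ (d ^ (k + 1))
  d^[k+1]≡ : ℕtoℚ (d ^ (k + 1)) ≡ ℕtoℚ d * ℕtoℚ (d ^ k)
  d^[k+1]≡ = trans (cong (λ t → ℕtoℚ (d ^ t)) (ℕP.+-comm k 1)) (ℕtoℚ-* d (d ^ k))
  instance
    d≢0 : NonZero d
    d≢0 = ℕ.>-nonZero 1≤d
    d^[k+1]≢0 : NonZero (d ^ (k + 1))
    d^[k+1]≢0 = ℕ.>-nonZero (ℕP.m^n>0 d (k + 1))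
  X>0 : ℚ.Positive X
  X>0 = ℚP.pos*pos⇒pos ε {{ℚ.positive 0<ε}} (ℕtoℚ (d ^ (k + 1))) {{ℚP.normalize-pos (d ^ (k + 1)) 1}}

lemma2p4 : (ε : ℚ) (k d n : ℕ) .{{_ : NonZero n}} (G₁ G₂ : Graph n) →
           0ℚ < ε → 1 ≤ k → 1 ≤ d →
           Bounded d G₁ → Bounded d G₂ → Close ε d G₁ G₂ →
           l1FreqDist k G₁ G₂ < (ℕtoℚ 6 * ε) * ℕtoℚ (d ^ (k + 1))
lemma2p4 ε k d (suc m) G₁ G₂ 0<ε _ 1≤d bounded₁ bounded₂ close = begin-strict
  l1FreqDist k G₁ G₂
    ≤⟨ l1FreqDist-≤ k m G₁ G₂ ⟩
  ℕtoℚ (typeDiscrepancy G₁ isRep₁ + typeDiscrepancy G₂ isRep₂) * 1/ (suc m)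
    ≤⟨ ℚP.*-monoʳ-≤-nonNeg (1/ (suc m)) {{1/-nonNeg m}}
         (ℕtoℚ-mono-≤ (typeDiscrepancy-≤-editDist k m G₁ G₂ bounded₁ bounded₂)) ⟩
  ℕtoℚ (editDist G₁ G₂ ℕ.* (4 ℕ.* d ^ k)) * 1/ (suc m)
    ≤⟨ ≤q*n⇒*c/n≤q*c {editDist G₁ G₂} (ε * ℕtoℚ d) m (4 ℕ.* d ^ k) close ⟩
  (ε * ℕtoℚ d) * ℕtoℚ (4 ℕ.* d ^ k)
    <⟨ 4εd^[k+1]<6εd^[k+1] ε k d 0<ε 1≤d ⟩
  (ℕtoℚ 6 * ε) * ℕtoℚ (d ^ (k + 1))
    ∎
  where
  open ℚP.≤-Reasoning
  open Discrepancy k G₁ G₂
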